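{- Let $B=(b_{ij})\in M_n(\mathbb{Z})$ be a skew-symmetrizable integer matrix. If $B'\in M_n(\mathbb{Z})$ is mutation equivalent to $B$, then \[ \delta(B')\equiv \delta(B)\pmod 4 . \]
   Context: A matrix $B=(b_{ij})\in M_n(\mathbb{Z})$ is skew-symmetrizable if there is a diagonal matrix $D=\operatorname{diag}(d_1,\dots,d_n)$ with positive integers $d_i$ such that $DB$ is skew-symmetric. For $k\in[n]=\{1,\dots,n\}$, the mutation $\mu_k(B)=(b'_{ij})$ is the matrix with $b'_{ij}=-b_{ij}$ if $i=k$ or $j=k$, and $b'_{ij}=b_{ij}+\max(0,-b_{ik})\,b_{kj}+b_{ik}\max(0,b_{kj})$ otherwise; $\mu_k(B)$ is again skew-symmetrizable with the same skew-symmetrizer. Two skew-symmetrizable matrices $B,B'\in M_n(\mathbb{Z})$ are mutation equivalent if one can be obtained from the other by a finite sequence of mutations, possibly followed by a simultaneous permutation of rows and columns (i.e. conjugation $B\mapsto PBP^{\top}$ by a permutation matrix $P$). The symmetrization of $B$ is the real symmetric matrix $\mathfrak{S}(B)=(s_{ij})$ with $s_{ii}=2$, $s_{ij}=\operatorname{sgn}(b_{ij})\sqrt{|b_{ij}b_{ji}|}$ for $i<j$, and $s_{ij}=\operatorname{sgn}(b_{ji})\sqrt{|b_{ij}b_{ji}|}$ for $i>j$, where $\operatorname{sgn}(0)=0$. One has $\det\mathfrak{S}(B)\in\mathbb{Z}$, and $\delta(B)$ denotes the residue of $\det(\mathfrak{S}(B))$ modulo $4$. -}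

module Defs where

open import Data.Nat as ℕ using (ℕ; zero; suc; _<ᵇ_; _≤ᵇ_)
open import Data.Integer as ℤ using (ℤ; +_; -_; _⊔_; ∣_∣; _%ℕ_; 0ℤ; 1ℤ; -1ℤ)
open import Data.Fin as Fin using (Fin; toℕ; _≟_)
open import Data.List as List using (List; []; _∷_; concatMap; map; foldr)
open import Data.Bool using (Bool; true; false; if_then_else_)
open import Data.Product using (Σ; ∃; _×_; _,_)
open import Data.Fin.Permutation using (Permutation′; _⟨$⟩ʳ_)
open import Relation.Nullary using (yes; no)
open import Relation.Binary.PropositionalEquality using (_≡_)
open import Relation.Binary.Construct.Closure.ReflexiveTransitive using (Star)

Matrix : ℕ → Set
Matrix n = Fin n → Fin n → ℤ

SkewSymmetrizable : ∀ {n} → Matrix n → Set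
SkewSymmetrizable {n} B =
  Σ (Fin n → ℕ) λ d →
    (∀ i → 0 ℕ.< d i) ×
    (∀ i j → (+ d i) ℤ.* B i j ≡ - ((+ d j) ℤ.* B j i))

pos : ℤ → ℤ
pos x = 0ℤ ⊔ x

mutate : ∀ {n} → Fin n → Matrix n → Matrix n
mutate k B i j with i ≟ k | j ≟ k
... | yes _ | _     = - B i j
... | no _  | yes _ = - B i j
... | no _  | no _  = B i j ℤ.+ pos (- B i k) ℤ.* B k j ℤ.+ B i k ℤ.* pos (B k j)

data MutStep {n} : Matrix n → Matrix n → Set where
  mut : (k : Fin n) (B : Matrix n) → MutStep B (mutate k B)

PermConj : ∀ {n} → Matrix n → Matrix n → Set
PermConj {n} B B' = Σ (Permutation′ n) λ π → ∀ i j → B' i j ≡ B (π ⟨$⟩ʳ i) (π ⟨$⟩ʳ j)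

MutationEquivalent : ∀ {n} → Matrix n → Matrix n → Set
MutationEquivalent B B' = ∃ λ C → Star MutStep B C × PermConj C B'

-- Each entry of 𝔖(B) has the form s_ij = ε_ij · √(m_ij) with ε_ij ∈ {-1,0,1}
-- and m_ij ∈ ℕ:  ε_ii = 1, m_ii = 4 (so s_ii = 2);  for i ≠ j,
-- m_ij = |b_ij b_ji|, ε_ij = sgn b_ij (i<j) resp. sgn b_ji (i>j).
-- A Leibniz term Π_i s_{i f(i)} equals (Π ε) · √(Π m), and for
-- skew-symmetrizable B the number Π m is a perfect square, so the real
-- square root is the natural number isqrt (Π m).

sgn : ℤ → ℤ
sgn (+ zero)  = 0ℤ
sgn (+ suc _) = 1ℤ
sgn ℤ.-[1+ _ ] = -1ℤ

isqrtFrom : ℕ → ℕ → ℕ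
isqrtFrom m zero    = zero
isqrtFrom m (suc k) = if (suc k ℕ.* suc k) ≤ᵇ m then suc k else isqrtFrom m k

isqrt : ℕ → ℕ
isqrt m = isqrtFrom m m

symSign : ∀ {n} → Matrix n → Fin n → Fin n → ℤ
symSign B i j with i ≟ j
... | yes _ = 1ℤ
... | no _  = if toℕ i <ᵇ toℕ j then sgn (B i j) else sgn (B j i)

symSq : ∀ {n} → Matrix n → Fin n → Fin n → ℕ
symSq B i j with i ≟ j
... | yes _ = 4
... | no _  = ∣ B i j ℤ.* B j i ∣

allFuns : (m n : ℕ) → List (Fin m → Fin n)
allFuns zero    n = (λ ()) ∷ []
allFuns (suc m) n =
  concatMap (λ f → map (λ a → λ { Fin.zero → a ; (Fin.suc i) → f i }) (List.allFin n))
            (allFuns m n)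

prodℤ : ∀ {n} → (Fin n → ℤ) → ℤ
prodℤ {zero}  g = 1ℤ
prodℤ {suc n} g = g Fin.zero ℤ.* prodℤ (λ i → g (Fin.suc i))

prodℕ : ∀ {n} → (Fin n → ℕ) → ℕ
prodℕ {zero}  g = 1
prodℕ {suc n} g = g Fin.zero ℕ.* prodℕ (λ i → g (Fin.suc i))

-- Sign of a map f : Fin n → Fin n via Π_{i<j} sgn(f j - f i):
-- the sign of the permutation if f is bijective, 0 otherwise.
sgnFun : ∀ {n} → (Fin n → Fin n) → ℤ
sgnFun f = prodℤ λ i → prodℤ λ j →
  if toℕ i <ᵇ toℕ j then sgn (+ toℕ (f j) ℤ.- + toℕ (f i)) else 1ℤ

sumℤ : List ℤ → ℤ
sumℤ = foldr ℤ._+_ 0ℤ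

detSym : ∀ {n} → Matrix n → ℤ
detSym {n} B = sumℤ (map term (allFuns n n))
  where
  term : (Fin n → Fin n) → ℤ
  term f = sgnFun f ℤ.* prodℤ (λ i → symSign B i (f i))
                    ℤ.* + isqrt (prodℕ (λ i → symSq B i (f i)))

δ : ∀ {n} → Matrix n → ℕ
δ B = detSym B %ℕ 4

-- Let A be the quasi-Cartan companion of B: 2 on the diagonal, b_ij above it and -b_ij below it.
-- For skew-symmetrizable B the products ∏ |b_i,f(i) b_f(i),i| along a permutation f are perfect
-- squares, and the Leibniz terms of det 𝔖(B) and det A coincide; so δ(B) = det A mod 4.
-- If D A and D A′ are symmetric, both have diagonal 2 and A′ ≡ A entrywise mod 2, then
-- det A′ ≡ det A mod 4: the terms of f and f⁻¹ agree, so the pairs {f , f⁻¹} contribute twice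
-- an even number to det A′ - det A, and on an involution the term is a product of factors
-- a_ij a_ji, each determined mod 4 by its entries mod 2 thanks to d_i a_ij = d_j a_ji.
-- The quasi-Cartan companion of μ_k(B) is congruent mod 2 to a D-symmetric matrix with diagonal 2
-- obtained from A by elementary row and column operations, and a simultaneous permutation only
-- permutes A up to signs; hence det A mod 4 is a mutation invariant.

module Submission where

open import Defs

open import Algebra.Bundles using (AbelianGroup)
import Algebra.Properties.CommutativeMonoid.Sum as MonoidSum
import Algebra.Properties.Group as GroupProperties
import Algebra.Properties.Semiring.Sum as SemiringSum
open import Data.Bool using (Bool; true; false; not; if_then_else_; T)
open import Data.Empty using (⊥-elim)
open import Data.Fin as Fin using (Fin; zero; suc; toℕ; _≟_)
open import Data.Fin.Permutation
  using (Permutation′; _⟨$⟩ʳ_; _⟨$⟩ˡ_; inverseˡ; inverseʳ; permutation; flip; _∘ₚ_; transpose)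
import Data.Fin.Permutation.Components as PC
import Data.Fin.Properties as FinP
open import Data.Integer as ℤ using (ℤ; +_; -_; _+_; _*_; _-_; 0ℤ; 1ℤ; -1ℤ)
import Data.Integer.Divisibility.Signed as ℤ∣
import Data.Integer.DivMod as ℤD
import Data.Integer.Properties as ℤP
open import Data.Integer.Solver using (module +-*-Solver)
open import Data.List as List using (List; []; _∷_; map; concatMap; _++_)
import Data.List.Properties as ListP
open import Data.Nat as ℕ using (ℕ; zero; suc; _<ᵇ_)
import Data.Nat.Divisibility as ℕ∣
open import Data.Nat.Primality using (euclidsLemma; prime?)
import Data.Nat.Properties as ℕP
open import Data.Product using (∃; ∃₂; _×_; _,_; proj₁; proj₂)
open import Data.Sum using (_⊎_; inj₁; inj₂)
import Data.Vec as Vec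
import Data.Vec.Functional as Vector
import Data.Vec.Properties as VecP
import Data.Vec.Relation.Binary.Lex.Strict as Lex
import Data.Vec.Relation.Binary.Pointwise.Inductive as Pointwise
open import Function using (_∘_; id)
open import Function.Bundles using (Injection)
open import Function.Definitions using (Injective)
open import Function.Properties.Inverse using (Inverse⇒Injection)
open import Relation.Binary.Bundles using (StrictTotalOrder; Setoid)
open import Relation.Binary.Construct.Closure.ReflexiveTransitive using (Star; ε; _◅_)
open import Relation.Binary.Definitions using (tri<; tri≈; tri>)
open import Relation.Binary.PropositionalEquality
import Relation.Binary.Reasoning.Setoid as SetoidReasoning
open import Relation.Nullary using (Dec; yes; no; ¬_)
open import Relation.Nullary.Decidable
  using (does; ¬?; _×-dec_; decidable-stable; dec-true; dec-false; from-yes)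

open +-*-Solver using (solve; _:+_; _:-_; _:*_; :-_; _:=_; con)

private
  variable
    m n N : ℕ
    E E′ : Set

module Σℤ = SemiringSum ℤP.+-*-semiring
module Πℤ = MonoidSum ℤP.*-1-commutativeMonoid

prodℤ≡product : (g : Fin n → ℤ) → prodℤ g ≡ Πℤ.sum g
prodℤ≡product {zero}  g = refl
prodℤ≡product {suc n} g = cong (g zero *_) (prodℤ≡product (g ∘ suc))

prodℤ-cong : {g h : Fin n → ℤ} → g ≗ h → prodℤ g ≡ prodℤ h
prodℤ-cong {zero}  e = refl
prodℤ-cong {suc n} e = cong₂ _*_ (e zero) (prodℤ-cong (e ∘ suc))

prodℤ-* : (g h : Fin n → ℤ) → prodℤ (λ i → g i * h i) ≡ prodℤ g * prodℤ h
prodℤ-* g h = begin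
  prodℤ (λ i → g i * h i)   ≡⟨ prodℤ≡product (λ i → g i * h i) ⟩
  Πℤ.sum (λ i → g i * h i)  ≡⟨ Πℤ.∑-distrib-+ g h ⟩
  Πℤ.sum g * Πℤ.sum h       ≡⟨ cong₂ _*_ (prodℤ≡product g) (prodℤ≡product h) ⟨
  prodℤ g * prodℤ h         ∎
  where open ≡-Reasoning

prodℤ-comm : (g : Fin m → Fin n → ℤ) →
  prodℤ (λ i → prodℤ (g i)) ≡ prodℤ (λ j → prodℤ (λ i → g i j))
prodℤ-comm g = begin
  prodℤ (λ i → prodℤ (g i))                 ≡⟨ prodℤ-cong (λ i → prodℤ≡product (g i)) ⟩
  prodℤ (λ i → Πℤ.sum (g i))                ≡⟨ prodℤ≡product (λ i → Πℤ.sum (g i)) ⟩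
  Πℤ.sum (λ i → Πℤ.sum (g i))               ≡⟨ Πℤ.∑-comm g ⟩
  Πℤ.sum (λ j → Πℤ.sum (λ i → g i j))       ≡⟨ prodℤ≡product (λ j → Πℤ.sum (λ i → g i j)) ⟨
  prodℤ (λ j → Πℤ.sum (λ i → g i j))        ≡⟨ prodℤ-cong (λ j → prodℤ≡product (λ i → g i j)) ⟨
  prodℤ (λ j → prodℤ (λ i → g i j))         ∎
  where open ≡-Reasoning

prodℤ-permute : (π : Permutation′ n) (g : Fin n → ℤ) → prodℤ g ≡ prodℤ (λ i → g (π ⟨$⟩ʳ i))
prodℤ-permute π g = begin
  prodℤ g                        ≡⟨ prodℤ≡product g ⟩
  Πℤ.sum g                       ≡⟨ Πℤ.∑-permute g π ⟩
  Πℤ.sum (λ i → g (π ⟨$⟩ʳ i))    ≡⟨ prodℤ≡product (λ i → g (π ⟨$⟩ʳ i)) ⟨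
  prodℤ (λ i → g (π ⟨$⟩ʳ i))     ∎
  where open ≡-Reasoning

prodℤ-ones : {g : Fin n → ℤ} → (∀ i → g i ≡ 1ℤ) → prodℤ g ≡ 1ℤ
prodℤ-ones {zero}  e = refl
prodℤ-ones {suc n} e = cong₂ _*_ (e zero) (prodℤ-ones (e ∘ suc))

prodℤ-zero : {g : Fin n → ℤ} (i : Fin n) → g i ≡ 0ℤ → prodℤ g ≡ 0ℤ
prodℤ-zero {suc n} {g} zero    e = cong (_* prodℤ (g ∘ suc)) e
prodℤ-zero {suc n} {g} (suc i) e =
  trans (cong (g zero *_) (prodℤ-zero i e)) (ℤP.*-zeroʳ (g zero))

+-prodℕ : (g : Fin n → ℕ) → + prodℕ g ≡ prodℤ (λ i → + g i)
+-prodℕ {zero}  g = refl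
+-prodℕ {suc n} g = trans (ℤP.pos-* (g zero) (prodℕ (g ∘ suc))) (cong (+ g zero *_) (+-prodℕ (g ∘ suc)))

sumOver : (E → ℤ) → List E → ℤ
sumOver F xs = sumℤ (map F xs)

sumOver-cong : {F G : E → ℤ} (xs : List E) → (∀ x → F x ≡ G x) → sumOver F xs ≡ sumOver G xs
sumOver-cong []       e = refl
sumOver-cong (x ∷ xs) e = cong₂ _+_ (e x) (sumOver-cong xs e)

sumOver-zeros : {F : E → ℤ} (xs : List E) → (∀ x → F x ≡ 0ℤ) → sumOver F xs ≡ 0ℤ
sumOver-zeros []       e = refl
sumOver-zeros (x ∷ xs) e = cong₂ _+_ (e x) (sumOver-zeros xs e)

sumOver-+ : (F G : E → ℤ) (xs : List E) → sumOver (λ x → F x + G x) xs ≡ sumOver F xs + sumOver G xs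
sumOver-+ F G []       = refl
sumOver-+ F G (x ∷ xs) =
  trans (cong (_+_ (F x + G x)) (sumOver-+ F G xs))
        (solve 4 (λ a b c d → a :+ b :+ (c :+ d) := a :+ c :+ (b :+ d)) refl (F x) (G x) _ _)

sumOver-*ˡ : (c : ℤ) (F : E → ℤ) (xs : List E) → sumOver (λ x → c * F x) xs ≡ c * sumOver F xs
sumOver-*ˡ c F []       = sym (ℤP.*-zeroʳ c)
sumOver-*ˡ c F (x ∷ xs) =
  trans (cong (_+_ (c * F x)) (sumOver-*ˡ c F xs)) (sym (ℤP.*-distribˡ-+ c (F x) _))

sumOver-*ʳ : (c : ℤ) (F : E → ℤ) (xs : List E) → sumOver (λ x → F x * c) xs ≡ sumOver F xs * c
sumOver-*ʳ c F xs = trans (sumOver-cong xs (λ x → ℤP.*-comm (F x) c))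
                          (trans (sumOver-*ˡ c F xs) (ℤP.*-comm c _))

sumOver-++ : (F : E → ℤ) (xs ys : List E) → sumOver F (xs ++ ys) ≡ sumOver F xs + sumOver F ys
sumOver-++ F []       ys = sym (ℤP.+-identityˡ _)
sumOver-++ F (x ∷ xs) ys = trans (cong (_+_ (F x)) (sumOver-++ F xs ys)) (sym (ℤP.+-assoc (F x) _ _))

sumOver-comm : (H : E → E′ → ℤ) (xs : List E) (ys : List E′) →
  sumOver (λ x → sumOver (H x) ys) xs ≡ sumOver (λ y → sumOver (λ x → H x y) xs) ys
sumOver-comm H []       ys = sym (sumOver-zeros ys (λ _ → refl))
sumOver-comm H (x ∷ xs) ys =
  trans (cong (_+_ (sumOver (H x) ys)) (sumOver-comm H xs ys))
        (sym (sumOver-+ (H x) (λ y → sumOver (λ x′ → H x′ y) xs) ys))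

sumOver-concatMap : (F : E′ → ℤ) (G : E → List E′) (xs : List E) →
  sumOver F (concatMap G xs) ≡ sumOver (λ x → sumOver F (G x)) xs
sumOver-concatMap F G []       = refl
sumOver-concatMap F G (x ∷ xs) =
  trans (sumOver-++ F (G x) (concatMap G xs)) (cong (_+_ (sumOver F (G x))) (sumOver-concatMap F G xs))

sumOver-map : (F : E′ → ℤ) (h : E → E′) (xs : List E) → sumOver F (map h xs) ≡ sumOver (F ∘ h) xs
sumOver-map F h []       = refl
sumOver-map F h (x ∷ xs) = cong (_+_ (F (h x))) (sumOver-map F h xs)

sumOver-allFin : (F : Fin n → ℤ) → sumOver F (List.allFin n) ≡ Σℤ.sum F
sumOver-allFin {zero}  F = refl
sumOver-allFin {suc n} F = cong (_+_ (F zero)) (begin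
  sumOver F (List.tabulate suc)      ≡⟨ cong (sumOver F) (ListP.map-tabulate id suc) ⟨
  sumOver F (map suc (List.allFin n)) ≡⟨ sumOver-map F suc (List.allFin n) ⟩
  sumOver (F ∘ suc) (List.allFin n)  ≡⟨ sumOver-allFin (F ∘ suc) ⟩
  Σℤ.sum (F ∘ suc)                   ∎)
  where open ≡-Reasoning

indicator : {P : Set} → Dec P → ℤ
indicator d = if does d then 1ℤ else 0ℤ

sum-indicator-≟ : (b : Fin n) → Σℤ.sum (λ a → indicator (a ≟ b)) ≡ 1ℤ
sum-indicator-≟ {suc n} zero    = cong (_+_ 1ℤ) (Σℤ.sum-replicate-zero n)
sum-indicator-≟ {suc n} (suc b) = trans (ℤP.+-identityˡ _) (sum-indicator-≟ b)

_≟ᶠ_ : (f g : Fin m → Fin N) → Dec (f ≗ g)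
f ≟ᶠ g = FinP.all? (λ i → f i ≟ g i)

Extensional : ((Fin m → Fin N) → ℤ) → Set
Extensional F = ∀ {f g} → f ≗ g → F f ≡ F g

sumFuns : ((Fin m → Fin N) → ℤ) → ℤ
sumFuns {m} {N} F = sumOver F (allFuns m N)

sumFuns-suc : (F : (Fin (suc m) → Fin N) → ℤ) → Extensional F →
  sumFuns F ≡ sumFuns (λ f → Σℤ.sum (λ a → F (a Vector.∷ f)))
sumFuns-suc {m} {N} F ext =
  trans (sumOver-concatMap F _ (allFuns m N)) (sumOver-cong (allFuns m N) λ f →
    trans (sumOver-map F _ (List.allFin N))
          (trans (sumOver-allFin {N} _) (Σℤ.sum-cong-≗ {N} λ a → ext λ { zero → refl ; (suc i) → refl })))

indicator-yes : {P : Set} (d : Dec P) → P → indicator d ≡ 1ℤ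
indicator-yes (yes _) _ = refl
indicator-yes (no ¬p) p = ⊥-elim (¬p p)

indicator-no : {P : Set} (d : Dec P) → ¬ P → indicator d ≡ 0ℤ
indicator-no (yes p) ¬p = ⊥-elim (¬p p)
indicator-no (no _)  _  = refl

indicator-cong : {P Q : Set} (d : Dec P) (e : Dec Q) → (P → Q) → (Q → P) → indicator d ≡ indicator e
indicator-cong (yes p) e      p⇒q q⇒p = sym (indicator-yes e (p⇒q p))
indicator-cong (no ¬p) e      p⇒q q⇒p = sym (indicator-no e (¬p ∘ q⇒p))

indicator-≟ᶠ-extensional : (h : Fin m → Fin N) → Extensional (λ g → indicator (g ≟ᶠ h))
indicator-≟ᶠ-extensional h {f} {g} f≗g =
  indicator-cong (f ≟ᶠ h) (g ≟ᶠ h) (λ e i → trans (sym (f≗g i)) (e i)) (λ e i → trans (f≗g i) (e i))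

indicator-∷ : (a : Fin N) (f : Fin m → Fin N) (h : Fin (suc m) → Fin N) →
  indicator ((a Vector.∷ f) ≟ᶠ h) ≡ indicator (a ≟ h zero) * indicator (f ≟ᶠ (h ∘ suc))
indicator-∷ a f h = on (a ≟ h zero)
  where
  on : (d : Dec (a ≡ h zero)) →
    indicator ((a Vector.∷ f) ≟ᶠ h) ≡ indicator d * indicator (f ≟ᶠ (h ∘ suc))
  on (yes p) = trans (indicator-cong ((a Vector.∷ f) ≟ᶠ h) (f ≟ᶠ (h ∘ suc))
                                     (_∘ suc) (λ q → λ { zero → p ; (suc i) → q i }))
                     (sym (ℤP.*-identityˡ (indicator (f ≟ᶠ (h ∘ suc)))))
  on (no ¬p) = indicator-no ((a Vector.∷ f) ≟ᶠ h) (λ e → ¬p (e zero))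

sumFuns-indicator : (h : Fin m → Fin N) → sumFuns (λ g → indicator (g ≟ᶠ h)) ≡ 1ℤ
sumFuns-indicator {zero}      h = refl
sumFuns-indicator {suc m} {N} h = begin
  sumFuns (λ g → indicator (g ≟ᶠ h))
    ≡⟨ sumFuns-suc _ (indicator-≟ᶠ-extensional h) ⟩
  sumFuns (λ f → Σℤ.sum (λ a → indicator ((a Vector.∷ f) ≟ᶠ h)))
    ≡⟨ sumOver-cong (allFuns m N) (λ f → Σℤ.sum-cong-≗ (λ a → indicator-∷ a f h)) ⟩
  sumFuns (λ f → Σℤ.sum (λ a → indicator (a ≟ h zero) * indicator (f ≟ᶠ (h ∘ suc))))
    ≡⟨ sumOver-cong (allFuns m N) (λ f → sym (Σℤ.*-distribʳ-sum _ (λ a → indicator (a ≟ h zero)))) ⟩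
  sumFuns (λ f → Σℤ.sum (λ a → indicator (a ≟ h zero)) * indicator (f ≟ᶠ (h ∘ suc)))
    ≡⟨ sumOver-cong (allFuns m N) (λ f → trans (cong (_* indicator (f ≟ᶠ (h ∘ suc))) (sum-indicator-≟ (h zero)))
                                         (ℤP.*-identityˡ (indicator (f ≟ᶠ (h ∘ suc))))) ⟩
  sumFuns (λ f → indicator (f ≟ᶠ (h ∘ suc)))
    ≡⟨ sumFuns-indicator (h ∘ suc) ⟩
  1ℤ ∎
  where open ≡-Reasoning

sumFuns-δ : (F : (Fin m → Fin N) → ℤ) → Extensional F → (h : Fin m → Fin N) →
  sumFuns (λ g → indicator (g ≟ᶠ h) * F g) ≡ F h
sumFuns-δ {m} {N} F ext h = begin
  sumFuns (λ g → indicator (g ≟ᶠ h) * F g)  ≡⟨ sumOver-cong (allFuns m N) pick ⟩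
  sumFuns (λ g → indicator (g ≟ᶠ h) * F h)  ≡⟨ sumOver-*ʳ (F h) _ (allFuns m N) ⟩
  sumFuns (λ g → indicator (g ≟ᶠ h)) * F h  ≡⟨ cong (_* F h) (sumFuns-indicator h) ⟩
  1ℤ * F h                                  ≡⟨ ℤP.*-identityˡ (F h) ⟩
  F h                                       ∎
  where
  open ≡-Reasoning
  pick : ∀ g → indicator (g ≟ᶠ h) * F g ≡ indicator (g ≟ᶠ h) * F h
  pick g = on (g ≟ᶠ h)
    where
    on : (d : Dec (g ≗ h)) → indicator d * F g ≡ indicator d * F h
    on (yes g≗h) = cong (1ℤ *_) (ext g≗h)
    on (no _)    = refl

sumFuns-comm : (H : (Fin m → Fin N) → (Fin m → Fin N) → ℤ) →
  sumFuns (λ f → sumFuns (H f)) ≡ sumFuns (λ g → sumFuns (λ f → H f g))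
sumFuns-comm {m} {N} H = sumOver-comm H (allFuns m N) (allFuns m N)

sumFuns-reindex : (Φ Ψ : (Fin m → Fin N) → (Fin m → Fin N)) →
  (∀ {f g} → f ≗ g → Φ f ≗ Φ g) → (∀ {f g} → f ≗ g → Ψ f ≗ Ψ g) →
  (∀ f → Ψ (Φ f) ≗ f) → (∀ g → Φ (Ψ g) ≗ g) →
  (H : (Fin m → Fin N) → ℤ) → Extensional H → sumFuns (H ∘ Φ) ≡ sumFuns H
sumFuns-reindex {m} {N} Φ Ψ Φ-cong Ψ-cong ΨΦ ΦΨ H ext = begin
  sumFuns (H ∘ Φ)
    ≡⟨ sumOver-cong (allFuns m N) (λ f → sumFuns-δ H ext (Φ f)) ⟨
  sumFuns (λ f → sumFuns (λ g → indicator (g ≟ᶠ Φ f) * H g))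
    ≡⟨ sumFuns-comm (λ f g → indicator (g ≟ᶠ Φ f) * H g) ⟩
  sumFuns (λ g → sumFuns (λ f → indicator (g ≟ᶠ Φ f) * H g))
    ≡⟨ sumOver-cong (allFuns m N) (λ g → sumOver-cong (allFuns m N) (λ f → cong (_* H g) (swap f g))) ⟩
  sumFuns (λ g → sumFuns (λ f → indicator (f ≟ᶠ Ψ g) * H g))
    ≡⟨ sumOver-cong (allFuns m N) (λ g → sumFuns-δ (λ _ → H g) (λ _ → refl) (Ψ g)) ⟩
  sumFuns H ∎
  where
  open ≡-Reasoning
  swap : ∀ f g → indicator (g ≟ᶠ Φ f) ≡ indicator (f ≟ᶠ Ψ g)
  swap f g = indicator-cong (g ≟ᶠ Φ f) (f ≟ᶠ Ψ g)
    (λ g≗Φf i → trans (sym (ΨΦ f i)) (sym (Ψ-cong g≗Φf i)))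
    (λ f≗Ψg i → trans (sym (ΦΨ g i)) (sym (Φ-cong f≗Ψg i)))

<ᵇ-irrefl : ∀ a → (a <ᵇ a) ≡ false
<ᵇ-irrefl zero    = refl
<ᵇ-irrefl (suc a) = <ᵇ-irrefl a

<ᵇ-flip : ∀ a b → a ≢ b → (b <ᵇ a) ≡ not (a <ᵇ b)
<ᵇ-flip zero    zero    a≢b = ⊥-elim (a≢b refl)
<ᵇ-flip zero    (suc b) a≢b = refl
<ᵇ-flip (suc a) zero    a≢b = refl
<ᵇ-flip (suc a) (suc b) a≢b = <ᵇ-flip a b (a≢b ∘ cong suc)

_<ᶠ_ : Fin n → Fin n → Bool
i <ᶠ j = toℕ i <ᵇ toℕ j

<ᶠ-irrefl : (i : Fin n) → (i <ᶠ i) ≡ false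
<ᶠ-irrefl i = <ᵇ-irrefl (toℕ i)

<ᶠ-flip : {i j : Fin n} → i ≢ j → (j <ᶠ i) ≡ not (i <ᶠ j)
<ᶠ-flip {i = i} {j} i≢j = <ᵇ-flip (toℕ i) (toℕ j) (i≢j ∘ FinP.toℕ-injective)

<ᶠ⇒≢ : {i j : Fin n} → (i <ᶠ j) ≡ true → i ≢ j
<ᶠ⇒≢ {i = i} i<j refl with () ← trans (sym (<ᶠ-irrefl i)) i<j

<ᶠ-asym : {i j : Fin n} → (i <ᶠ j) ≡ true → (j <ᶠ i) ≡ false
<ᶠ-asym {i = i} {j} i<j = trans (<ᶠ-flip (<ᶠ⇒≢ {i = i} {j} i<j)) (cong not i<j)

<ᶠ-connex : {i j : Fin n} → (i <ᶠ j) ≡ false → (j <ᶠ i) ≡ false → i ≡ j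
<ᶠ-connex {i = i} {j} i≮j j≮i with i ≟ j
... | yes i≡j = i≡j
... | no i≢j with () ← trans (sym j≮i) (trans (<ᶠ-flip i≢j) (cong not i≮j))

⟨$⟩ʳ-injective : (π : Permutation′ n) → Injective _≡_ _≡_ (π ⟨$⟩ʳ_)
⟨$⟩ʳ-injective π = Injection.injective (Inverse⇒Injection π)

signOf : Fin n → Fin n → ℤ
signOf a b = sgn (+ toℕ b - + toℕ a)

sgn-neg : ∀ x → sgn (- x) ≡ - sgn x
sgn-neg (+ zero)  = refl
sgn-neg (+ suc _) = refl
sgn-neg ℤ.-[1+ _ ] = refl

sgn-* : ∀ x → x ≢ 0ℤ → sgn x * sgn x ≡ 1ℤ
sgn-* (+ zero)   x≢0 = ⊥-elim (x≢0 refl)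
sgn-* (+ suc _)  _   = refl
sgn-* ℤ.-[1+ _ ] _   = refl

signOf-antisym : (a b : Fin n) → signOf b a ≡ - signOf a b
signOf-antisym a b = trans (cong sgn (solve 2 (λ x y → x :- y := :- (y :- x)) refl (+ toℕ a) (+ toℕ b)))
                           (sgn-neg (+ toℕ b - + toℕ a))

signOf-self : (a : Fin n) → signOf a a ≡ 0ℤ
signOf-self a = cong sgn (ℤP.+-inverseʳ (+ toℕ a))

signOf-* : {a b : Fin n} → a ≢ b → signOf a b * signOf a b ≡ 1ℤ
signOf-* {a = a} {b} a≢b = sgn-* _ λ e →
  a≢b (FinP.toℕ-injective (ℤP.+-injective (sym (ℤP.i-j≡0⇒i≡j (+ toℕ b) (+ toℕ a) e))))

signOf-< : (a b : Fin n) → (a <ᶠ b) ≡ true → signOf a b ≡ 1ℤ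
signOf-< a b a<b = trans (cong sgn (ℤP.m-n≡m⊖n (toℕ b) (toℕ a))) (⊖-positive (toℕ a) (toℕ b) a<b)
  where
  ⊖-positive : ∀ x y → (x <ᵇ y) ≡ true → sgn (y ℤ.⊖ x) ≡ 1ℤ
  ⊖-positive zero    (suc y) _ = refl
  ⊖-positive (suc x) (suc y) e = trans (cong sgn (ℤP.[1+m]⊖[1+n]≡m⊖n y x)) (⊖-positive x y e)

∏[_] : (Fin n → Fin n → Bool) → (Fin n → Fin n → ℤ) → ℤ
∏[ P ] φ = prodℤ λ i → prodℤ λ j → if P i j then φ i j else 1ℤ

record IsTournament (P : Fin n → Fin n → Bool) : Set where
  field
    irreflexive : ∀ i → P i i ≡ false
    flip-≢      : ∀ {i j} → i ≢ j → P j i ≡ not (P i j)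

∏-cong : (P : Fin n → Fin n → Bool) {φ ψ : Fin n → Fin n → ℤ} →
  (∀ i j → P i j ≡ true → φ i j ≡ ψ i j) → ∏[ P ] φ ≡ ∏[ P ] ψ
∏-cong P {φ} {ψ} e = prodℤ-cong λ i → prodℤ-cong λ j → on i j (P i j) refl
  where
  on : ∀ i j b → P i j ≡ b → (if b then φ i j else 1ℤ) ≡ (if b then ψ i j else 1ℤ)
  on i j true  Pij = e i j Pij
  on i j false _   = refl

∏-* : (P : Fin n → Fin n → Bool) (φ ψ : Fin n → Fin n → ℤ) →
  ∏[ P ] (λ i j → φ i j * ψ i j) ≡ ∏[ P ] φ * ∏[ P ] ψ
∏-* {n} P φ ψ =
  trans (prodℤ-cong λ i → trans (prodℤ-cong λ j → split (P i j)) (prodℤ-* {n} _ _)) (prodℤ-* {n} _ _)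
  where
  split : ∀ {x y} b → (if b then x * y else 1ℤ) ≡ (if b then x else 1ℤ) * (if b then y else 1ℤ)
  split true  = refl
  split false = refl

∏-permute : (π : Permutation′ n) (P : Fin n → Fin n → Bool) (φ : Fin n → Fin n → ℤ) →
  ∏[ P ] (λ i j → φ (π ⟨$⟩ʳ i) (π ⟨$⟩ʳ j)) ≡ ∏[ (λ a b → P (π ⟨$⟩ˡ a) (π ⟨$⟩ˡ b)) ] φ
∏-permute π P φ =
  trans (prodℤ-permute (flip π) _) (prodℤ-cong λ a →
  trans (prodℤ-permute (flip π) _) (prodℤ-cong λ b →
    cong₂ (λ x y → if P (π ⟨$⟩ˡ a) (π ⟨$⟩ˡ b) then φ x y else 1ℤ) (inverseʳ π) (inverseʳ π)))

-- Both sides take one factor φ i j = φ j i from every pair {i , j}.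
∏-tournament : {P Q : Fin n → Fin n → Bool} → IsTournament P → IsTournament Q →
  (φ : Fin n → Fin n → ℤ) → (∀ i j → φ i j ≡ φ j i) → ∏[ P ] φ ≡ ∏[ Q ] φ
∏-tournament {n} {P} {Q} tP tQ φ φ-sym = begin
  prodℤ² X                                                             ≡⟨ prodℤ²-cong (λ i j → split (Q i j)) ⟩
  prodℤ² (λ i j → (if Q i j then X i j else 1ℤ) * (if Q i j then 1ℤ else X i j))
    ≡⟨ prodℤ²-* (λ i j → if Q i j then X i j else 1ℤ) (λ i j → if Q i j then 1ℤ else X i j) ⟩
  prodℤ² (λ i j → if Q i j then X i j else 1ℤ) * prodℤ² (λ i j → if Q i j then 1ℤ else X i j)
    ≡⟨ cong (prodℤ² (λ i j → if Q i j then X i j else 1ℤ) *_)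
            (trans (prodℤ-comm (λ i j → if Q i j then 1ℤ else X i j)) (prodℤ²-cong transposed)) ⟩
  prodℤ² (λ i j → if Q i j then X i j else 1ℤ) * prodℤ² (λ i j → if Q i j then X j i else 1ℤ)
    ≡⟨ prodℤ²-* (λ i j → if Q i j then X i j else 1ℤ) (λ i j → if Q i j then X j i else 1ℤ) ⟨
  prodℤ² (λ i j → (if Q i j then X i j else 1ℤ) * (if Q i j then X j i else 1ℤ))
    ≡⟨ prodℤ²-cong pair ⟩
  ∏[ Q ] φ ∎
  where
  open ≡-Reasoning
  open IsTournament
  prodℤ² : (Fin n → Fin n → ℤ) → ℤ
  prodℤ² g = prodℤ λ i → prodℤ (g i)
  prodℤ²-cong : {g h : Fin n → Fin n → ℤ} → (∀ i j → g i j ≡ h i j) → prodℤ² g ≡ prodℤ² h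
  prodℤ²-cong e = prodℤ-cong λ i → prodℤ-cong (e i)
  prodℤ²-* : (g h : Fin n → Fin n → ℤ) → prodℤ² (λ i j → g i j * h i j) ≡ prodℤ² g * prodℤ² h
  prodℤ²-* g h = trans (prodℤ-cong λ i → prodℤ-* (g i) (h i)) (prodℤ-* {n} _ _)
  X : Fin n → Fin n → ℤ
  X i j = if P i j then φ i j else 1ℤ
  split : ∀ {x} b → x ≡ (if b then x else 1ℤ) * (if b then 1ℤ else x)
  split {x} true  = sym (ℤP.*-identityʳ x)
  split {x} false = sym (ℤP.*-identityˡ x)
  transposed : ∀ i j → (if Q j i then 1ℤ else X j i) ≡ (if Q i j then X j i else 1ℤ)
  transposed i j with i ≟ j
  ... | yes refl rewrite irreflexive tQ i | irreflexive tP i = refl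
  ... | no i≢j   rewrite flip-≢ tQ i≢j with Q i j
  ...   | true  = refl
  ...   | false = refl
  pair : ∀ i j → (if Q i j then X i j else 1ℤ) * (if Q i j then X j i else 1ℤ) ≡ (if Q i j then φ i j else 1ℤ)
  pair i j with i ≟ j
  ... | yes refl rewrite irreflexive tQ i = refl
  ... | no i≢j with Q i j | P i j | flip-≢ tP i≢j
  ...   | false | _     | _       = refl
  ...   | true  | true  | Pji rewrite Pji = ℤP.*-identityʳ (φ i j)
  ...   | true  | false | Pji rewrite Pji = trans (ℤP.*-identityˡ (φ j i)) (φ-sym j i)

<ᶠ-isTournament : IsTournament {n} _<ᶠ_
<ᶠ-isTournament = record { irreflexive = <ᶠ-irrefl ; flip-≢ = <ᶠ-flip }

<ᶠ-permuted-isTournament : (π : Permutation′ n) → IsTournament (λ a b → (π ⟨$⟩ˡ a) <ᶠ (π ⟨$⟩ˡ b))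
<ᶠ-permuted-isTournament π = record
  { irreflexive = λ a → <ᶠ-irrefl (π ⟨$⟩ˡ a)
  ; flip-≢      = λ a≢b → <ᶠ-flip (a≢b ∘ ⟨$⟩ʳ-injective (flip π))
  }

sgnFun-cong : {f g : Fin n → Fin n} → f ≗ g → sgnFun f ≡ sgnFun g
sgnFun-cong f≗g = ∏-cong _<ᶠ_ (λ i j _ → cong₂ signOf (f≗g i) (f≗g j))

ordered-factor : (a b : Fin n) → (if a <ᶠ b then signOf a b else 1ℤ) ≡ 1ℤ
ordered-factor a b with a <ᶠ b in a<b
... | true  = signOf-< a b a<b
... | false = refl

sgnFun-id : sgnFun {n} id ≡ 1ℤ
sgnFun-id {n} = prodℤ-ones {n} λ i → prodℤ-ones {n} λ j → ordered-factor i j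

sgnFun-collision : (f : Fin n → Fin n) {i j : Fin n} → i ≢ j → f i ≡ f j → sgnFun f ≡ 0ℤ
sgnFun-collision f {i} {j} i≢j fi≡fj = on (i <ᶠ j) refl
  where
  vanishes : ∀ a b → f a ≡ f b → (a <ᶠ b) ≡ true → sgnFun f ≡ 0ℤ
  vanishes a b fa≡fb a<b = prodℤ-zero a (prodℤ-zero b
    (trans (cong (λ c → if c then signOf (f a) (f b) else 1ℤ) a<b)
           (trans (cong (signOf (f a)) (sym fa≡fb)) (signOf-self (f a)))))
  on : ∀ c → (i <ᶠ j) ≡ c → sgnFun f ≡ 0ℤ
  on true  i<j = vanishes i j fi≡fj i<j
  on false i≮j = vanishes j i (sym fi≡fj) (trans (<ᶠ-flip i≢j) (cong not i≮j))

-- Each factor sign(g(π j) - g(π i)) is sign(π j - π i) times a factor symmetric in π i, π j.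
sgnFun-∘ : (g : Fin n → Fin n) (π : Permutation′ n) →
  sgnFun (g ∘ (π ⟨$⟩ʳ_)) ≡ sgnFun g * sgnFun (π ⟨$⟩ʳ_)
sgnFun-∘ g π = begin
  sgnFun (g ∘ π⃗)
    ≡⟨ ∏-cong _<ᶠ_ (λ i j i<j → split (π⃗ i) (π⃗ j) (<ᶠ⇒≢ i<j ∘ ⟨$⟩ʳ-injective π)) ⟩
  ∏[ _<ᶠ_ ] (λ i j → ψ (π⃗ i) (π⃗ j) * signOf (π⃗ i) (π⃗ j))
    ≡⟨ ∏-* _<ᶠ_ (λ i j → ψ (π⃗ i) (π⃗ j)) (λ i j → signOf (π⃗ i) (π⃗ j)) ⟩
  ∏[ _<ᶠ_ ] (λ i j → ψ (π⃗ i) (π⃗ j)) * sgnFun π⃗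
    ≡⟨ cong (_* sgnFun π⃗) (∏-permute π _<ᶠ_ ψ) ⟩
  ∏[ (λ a b → (π ⟨$⟩ˡ a) <ᶠ (π ⟨$⟩ˡ b)) ] ψ * sgnFun π⃗
    ≡⟨ cong (_* sgnFun π⃗) (∏-tournament (<ᶠ-permuted-isTournament π) <ᶠ-isTournament ψ ψ-sym) ⟩
  ∏[ _<ᶠ_ ] ψ * sgnFun π⃗
    ≡⟨ cong (_* sgnFun π⃗) (∏-cong _<ᶠ_ λ a b a<b → trans (cong (signOf (g a) (g b) *_) (signOf-< a b a<b))
                                                          (ℤP.*-identityʳ _)) ⟩
  sgnFun g * sgnFun π⃗ ∎
  where
  open ≡-Reasoning
  π⃗ : Fin _ → Fin _
  π⃗ = π ⟨$⟩ʳ_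
  ψ : Fin _ → Fin _ → ℤ
  ψ a b = signOf (g a) (g b) * signOf a b
  ψ-sym : ∀ a b → ψ a b ≡ ψ b a
  ψ-sym a b = begin
    signOf (g a) (g b) * signOf a b
      ≡⟨ solve 2 (λ x y → x :* y := (:- x) :* (:- y)) refl (signOf (g a) (g b)) (signOf a b) ⟩
    - signOf (g a) (g b) * - signOf a b
      ≡⟨ cong₂ _*_ (signOf-antisym (g a) (g b)) (signOf-antisym a b) ⟨
    signOf (g b) (g a) * signOf b a          ∎
  split : ∀ a b → a ≢ b → signOf (g a) (g b) ≡ ψ a b * signOf a b
  split a b a≢b = begin
    signOf (g a) (g b)                               ≡⟨ ℤP.*-identityʳ _ ⟨
    signOf (g a) (g b) * 1ℤ                          ≡⟨ cong (signOf (g a) (g b) *_) (signOf-* a≢b) ⟨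
    signOf (g a) (g b) * (signOf a b * signOf a b)   ≡⟨ ℤP.*-assoc (signOf (g a) (g b)) (signOf a b) (signOf a b) ⟨
    ψ a b * signOf a b                               ∎

Collision : (Fin n → Fin n) → Set
Collision f = ∃₂ λ i j → i ≢ j × f i ≡ f j

injective-or-collision : (f : Fin n → Fin n) → Injective _≡_ _≡_ f ⊎ Collision f
injective-or-collision f with FinP.any? (λ i → FinP.any? (λ j → ¬? (i ≟ j) ×-dec (f i ≟ f j)))
... | yes (i , j , i≢j , fi≡fj) = inj₂ (i , j , i≢j , fi≡fj)
... | no none = inj₁ λ {x} {y} fx≡fy → decidable-stable (x ≟ y) (λ x≢y → none (x , y , x≢y , fx≡fy))

injective⇒surjective : (f : Fin n → Fin n) → Injective _≡_ _≡_ f → ∀ y → ∃ λ x → f x ≡ y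
injective⇒surjective {suc n} f inj y with FinP.any? (λ x → f x ≟ y)
... | yes hit = hit
... | no miss = ⊥-elim (ℕP.<-irrefl refl (FinP.injective⇒≤ squeezed-injective))
  where
  squeezed : Fin (suc n) → Fin n
  squeezed x = Fin.punchOut {i = y} {j = f x} (λ e → miss (x , sym e))
  squeezed-injective : Injective _≡_ _≡_ squeezed
  squeezed-injective {a} {b} e = inj (FinP.punchOut-injective (λ e → miss (a , sym e)) (λ e → miss (b , sym e)) e)

injective⇒permutation : (f : Fin n → Fin n) → Injective _≡_ _≡_ f → Permutation′ n
injective⇒permutation f inj = permutation f (λ y → proj₁ (surj y)) (λ y → proj₂ (surj y))
                                          (λ x → inj (proj₂ (surj (f x))))
  where surj = injective⇒surjective f inj

i*j≡1⇒i≡j : ∀ x y → x * y ≡ 1ℤ → x ≡ y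
i*j≡1⇒i≡j (+ 1)           y e = trans (sym e) (ℤP.*-identityˡ y)
i*j≡1⇒i≡j ℤ.-[1+ 0 ]      y e = trans (cong -_ (sym e)) (trans (cong -_ (ℤP.-1*i≡-i y)) (ℤP.neg-involutive y))
i*j≡1⇒i≡j (+ 0)           y ()
i*j≡1⇒i≡j x@(+ suc (suc k)) y e
  with () ← ℕP.m*n≡1⇒m≡1 (suc (suc k)) ℤ.∣ y ∣ (trans (sym (ℤP.abs-* x y)) (cong ℤ.∣_∣ e))
i*j≡1⇒i≡j x@(ℤ.-[1+ suc k ]) y e
  with () ← ℕP.m*n≡1⇒m≡1 (suc (suc k)) ℤ.∣ y ∣ (trans (sym (ℤP.abs-* x y)) (cong ℤ.∣_∣ e))

sgnFun-inverse-* : (π : Permutation′ n) → sgnFun (π ⟨$⟩ˡ_) * sgnFun (π ⟨$⟩ʳ_) ≡ 1ℤ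
sgnFun-inverse-* {n} π =
  trans (sym (sgnFun-∘ (π ⟨$⟩ˡ_) π)) (trans (sgnFun-cong (λ _ → inverseˡ π)) (sgnFun-id {n}))

sgnFun-inverse : (π : Permutation′ n) → sgnFun (π ⟨$⟩ˡ_) ≡ sgnFun (π ⟨$⟩ʳ_)
sgnFun-inverse π = i*j≡1⇒i≡j _ _ (sgnFun-inverse-* π)

sgnFun-∘ˡ : (π : Permutation′ n) (f : Fin n → Fin n) →
  sgnFun ((π ⟨$⟩ʳ_) ∘ f) ≡ sgnFun (π ⟨$⟩ʳ_) * sgnFun f
sgnFun-∘ˡ π f with injective-or-collision f
... | inj₁ inj                 = sgnFun-∘ (π ⟨$⟩ʳ_) (injective⇒permutation f inj)
... | inj₂ (i , j , i≢j , fi≡fj) = begin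
  sgnFun ((π ⟨$⟩ʳ_) ∘ f)       ≡⟨ sgnFun-collision ((π ⟨$⟩ʳ_) ∘ f) i≢j (cong (π ⟨$⟩ʳ_) fi≡fj) ⟩
  0ℤ                            ≡⟨ ℤP.*-zeroʳ (sgnFun (π ⟨$⟩ʳ_)) ⟨
  sgnFun (π ⟨$⟩ʳ_) * 0ℤ         ≡⟨ cong (sgnFun (π ⟨$⟩ʳ_) *_) (sgnFun-collision f i≢j fi≡fj) ⟨
  sgnFun (π ⟨$⟩ʳ_) * sgnFun f   ∎
  where open ≡-Reasoning

sgnFun-conj : (π : Permutation′ n) (g : Fin n → Fin n) →
  sgnFun ((π ⟨$⟩ʳ_) ∘ g ∘ (π ⟨$⟩ˡ_)) ≡ sgnFun g
sgnFun-conj π g = begin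
  sgnFun ((π ⟨$⟩ʳ_) ∘ g ∘ (π ⟨$⟩ˡ_))            ≡⟨ sgnFun-∘ ((π ⟨$⟩ʳ_) ∘ g) (flip π) ⟩
  sgnFun ((π ⟨$⟩ʳ_) ∘ g) * sgnFun (π ⟨$⟩ˡ_)     ≡⟨ cong (_* sgnFun (π ⟨$⟩ˡ_)) (sgnFun-∘ˡ π g) ⟩
  sgnFun (π ⟨$⟩ʳ_) * sgnFun g * sgnFun (π ⟨$⟩ˡ_)
    ≡⟨ solve 3 (λ p s q → p :* s :* q := s :* (q :* p)) refl (sgnFun (π ⟨$⟩ʳ_)) (sgnFun g) (sgnFun (π ⟨$⟩ˡ_)) ⟩
  sgnFun g * (sgnFun (π ⟨$⟩ˡ_) * sgnFun (π ⟨$⟩ʳ_)) ≡⟨ cong (sgnFun g *_) (sgnFun-inverse-* π) ⟩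
  sgnFun g * 1ℤ                                  ≡⟨ ℤP.*-identityʳ (sgnFun g) ⟩
  sgnFun g                                       ∎
  where open ≡-Reasoning

transpose-matchˡ : (i j : Fin n) → PC.transpose i j i ≡ j
transpose-matchˡ i j rewrite dec-true (i ≟ i) refl = refl

transpose-matchʳ : (i j : Fin n) → PC.transpose i j j ≡ i
transpose-matchʳ i j = on (j ≟ i)
  where
  on : Dec (j ≡ i) → PC.transpose i j j ≡ i
  on (yes j≡i) rewrite dec-true (j ≟ i) j≡i = j≡i
  on (no j≢i)  rewrite dec-false (j ≟ i) j≢i | dec-true (j ≟ j) refl = refl

transpose-other : {i j k : Fin n} → k ≢ i → k ≢ j → PC.transpose i j k ≡ k
transpose-other {i = i} {j} {k} k≢i k≢j rewrite dec-false (k ≟ i) k≢i | dec-false (k ≟ j) k≢j = refl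

transpose-conj : (π : Permutation′ n) (i j x : Fin n) →
  PC.transpose (π ⟨$⟩ʳ i) (π ⟨$⟩ʳ j) (π ⟨$⟩ʳ x) ≡ π ⟨$⟩ʳ PC.transpose i j x
transpose-conj π i j x = on (x ≟ i) (x ≟ j)
  where
  on : Dec (x ≡ i) → Dec (x ≡ j) →
    PC.transpose (π ⟨$⟩ʳ i) (π ⟨$⟩ʳ j) (π ⟨$⟩ʳ x) ≡ π ⟨$⟩ʳ PC.transpose i j x
  on (yes refl) _          = trans (transpose-matchˡ (π ⟨$⟩ʳ i) (π ⟨$⟩ʳ j))
                                   (cong (π ⟨$⟩ʳ_) (sym (transpose-matchˡ i j)))
  on (no _)     (yes refl) = trans (transpose-matchʳ (π ⟨$⟩ʳ i) (π ⟨$⟩ʳ j))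
                                   (cong (π ⟨$⟩ʳ_) (sym (transpose-matchʳ i j)))
  on (no x≢i)   (no x≢j)   = trans (transpose-other (x≢i ∘ ⟨$⟩ʳ-injective π) (x≢j ∘ ⟨$⟩ʳ-injective π))
                                   (cong (π ⟨$⟩ʳ_) (sym (transpose-other x≢i x≢j)))

sgnFun-transpose-conj : (π : Permutation′ n) (i j : Fin n) →
  sgnFun (PC.transpose (π ⟨$⟩ʳ i) (π ⟨$⟩ʳ j)) ≡ sgnFun (PC.transpose i j)
sgnFun-transpose-conj π i j = trans (sgnFun-cong conj) (sgnFun-conj π (PC.transpose i j))
  where
  conj : PC.transpose (π ⟨$⟩ʳ i) (π ⟨$⟩ʳ j) ≗ (π ⟨$⟩ʳ_) ∘ PC.transpose i j ∘ (π ⟨$⟩ˡ_)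
  conj y = trans (cong (PC.transpose (π ⟨$⟩ʳ i) (π ⟨$⟩ʳ j)) (sym (inverseʳ π)))
                 (transpose-conj π i j (π ⟨$⟩ˡ y))

sgnFun-transpose₀₁ : sgnFun (PC.transpose {suc (suc m)} zero (suc zero)) ≡ -1ℤ
sgnFun-transpose₀₁ {m} =
  cong₂ _*_ row₀ (cong₂ _*_ row₁ (prodℤ-ones {g = λ k → prodℤ (row (suc (suc k)))} rowₖ))
  where
  row : Fin (suc (suc m)) → Fin (suc (suc m)) → ℤ
  row i j = if i <ᶠ j then signOf (PC.transpose zero (suc zero) i) (PC.transpose zero (suc zero) j) else 1ℤ
  row₀ : prodℤ (row zero) ≡ -1ℤ
  row₀ = cong (λ x → 1ℤ * (-1ℤ * x))
              (prodℤ-ones {g = λ k → row zero (suc (suc k))} λ k → signOf-< zero (suc (suc k)) refl)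
  row₁ : prodℤ (row (suc zero)) ≡ 1ℤ
  row₁ = prodℤ-ones {g = row (suc zero)}
    λ { zero → refl ; (suc zero) → refl ; (suc (suc k)) → signOf-< zero (suc (suc k)) refl }
  rowₖ : (k : Fin m) → prodℤ (row (suc (suc k))) ≡ 1ℤ
  rowₖ k = prodℤ-ones {g = row (suc (suc k))}
    λ { zero → refl ; (suc zero) → refl ; (suc (suc l)) → ordered-factor (suc (suc k)) (suc (suc l)) }

sgnFun-transpose : {i j : Fin n} → i ≢ j → sgnFun (PC.transpose i j) ≡ -1ℤ
sgnFun-transpose {suc zero}    {zero} {zero} i≢j = ⊥-elim (i≢j refl)
sgnFun-transpose {suc (suc m)} {i}    {j}    i≢j =
  subst₂ (λ a b → sgnFun (PC.transpose a b) ≡ -1ℤ) S₀ S₁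
         (trans (sgnFun-transpose-conj S zero (suc zero)) (sgnFun-transpose₀₁ {m}))
  where
  c : Fin (suc (suc m))
  c = PC.transpose i zero j
  S : Permutation′ (suc (suc m))
  S = transpose (suc zero) c ∘ₚ transpose zero i
  c≢0 : c ≢ zero
  c≢0 c≡0 = i≢j (trans (sym (transpose-matchˡ zero i))
                      (trans (cong (PC.transpose zero i) (sym c≡0)) (PC.transpose-inverse zero i)))
  S₀ : S ⟨$⟩ʳ zero ≡ i
  S₀ = trans (cong (PC.transpose zero i) (transpose-other {i = suc zero} {c} (λ ()) (c≢0 ∘ sym)))
             (transpose-matchˡ zero i)
  S₁ : S ⟨$⟩ʳ suc zero ≡ j
  S₁ = trans (cong (PC.transpose zero i) (transpose-matchˡ (suc zero) c)) (PC.transpose-inverse zero i)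

transpose-sym : (i j : Fin n) → PC.transpose i j ≗ PC.transpose j i
transpose-sym i j k = on (k ≟ i) (k ≟ j)
  where
  on : Dec (k ≡ i) → Dec (k ≡ j) → PC.transpose i j k ≡ PC.transpose j i k
  on (yes refl) _          = trans (transpose-matchˡ k j) (sym (transpose-matchʳ j k))
  on (no _)     (yes refl) = trans (transpose-matchʳ i k) (sym (transpose-matchˡ k i))
  on (no k≢i)   (no k≢j)   = trans (transpose-other k≢i k≢j) (sym (transpose-other k≢j k≢i))

transpose-involutive : (i j k : Fin n) → PC.transpose i j (PC.transpose i j k) ≡ k
transpose-involutive i j k = trans (cong (PC.transpose i j) (transpose-sym i j k)) (PC.transpose-inverse i j)

-- Leibniz determinants

term : Matrix n → (Fin n → Fin n) → ℤ
term M f = sgnFun f * prodℤ (λ i → M i (f i))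

det : Matrix n → ℤ
det M = sumFuns (term M)

_ᵀ : Matrix n → Matrix n
(M ᵀ) i j = M j i

term-extensional : (M : Matrix n) → Extensional (term M)
term-extensional M f≗g = cong₂ _*_ (sgnFun-cong f≗g) (prodℤ-cong λ i → cong (M i) (f≗g i))

term-collision : (M : Matrix n) {f : Fin n → Fin n} → Collision f → term M f ≡ 0ℤ
term-collision M {f} (i , j , i≢j , fi≡fj) = cong (_* prodℤ (λ k → M k (f k))) (sgnFun-collision f i≢j fi≡fj)

det-cong : {M N : Matrix n} → (∀ i j → M i j ≡ N i j) → det M ≡ det N
det-cong {n} e = sumOver-cong (allFuns n n) λ f → cong (sgnFun f *_) (prodℤ-cong λ i → e i (f i))

det-conj : (π : Permutation′ n) (M : Matrix n) → det (λ i j → M (π ⟨$⟩ʳ i) (π ⟨$⟩ʳ j)) ≡ det M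
det-conj {n} π M = begin
  det (λ i j → M (π ⟨$⟩ʳ i) (π ⟨$⟩ʳ j))   ≡⟨ sumOver-cong (allFuns n n) conj-term ⟩
  sumFuns (term M ∘ Φ)                     ≡⟨ sumFuns-reindex Φ Ψ (λ e i → cong (π ⟨$⟩ʳ_) (e _))
                                                 (λ e i → cong (π ⟨$⟩ˡ_) (e _))
                                                 (λ f i → trans (inverseˡ π) (cong f (inverseˡ π)))
                                                 (λ g i → trans (inverseʳ π) (cong g (inverseʳ π)))
                                                 (term M) (term-extensional M) ⟩
  det M                                    ∎
  where
  open ≡-Reasoning
  Φ Ψ : (Fin n → Fin n) → Fin n → Fin n
  Φ f = (π ⟨$⟩ʳ_) ∘ f ∘ (π ⟨$⟩ˡ_)
  Ψ g = (π ⟨$⟩ˡ_) ∘ g ∘ (π ⟨$⟩ʳ_)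
  conj-term : ∀ f → term (λ i j → M (π ⟨$⟩ʳ i) (π ⟨$⟩ʳ j)) f ≡ term M (Φ f)
  conj-term f = cong₂ _*_ (sym (sgnFun-conj π f))
    (trans (prodℤ-permute (flip π) _) (prodℤ-cong λ i → cong (λ x → M x (Φ f i)) (inverseʳ π)))

invert : (Fin n → Fin n) → Fin n → Fin n
invert f with injective-or-collision f
... | inj₁ inj = injective⇒permutation f inj ⟨$⟩ˡ_
... | inj₂ _   = f

collision-≗ : {f g : Fin n → Fin n} → f ≗ g → Collision f → Collision g
collision-≗ f≗g (i , j , i≢j , fi≡fj) = i , j , i≢j , trans (sym (f≗g i)) (trans fi≡fj (f≗g j))

invert-cong : {f g : Fin n → Fin n} → f ≗ g → invert f ≗ invert g
invert-cong {f = f} {g} f≗g with injective-or-collision f | injective-or-collision g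
... | inj₁ f-inj | inj₁ _ = λ y → f-inj (trans (inverseʳ (injective⇒permutation f _))
                                         (sym (trans (f≗g _) (inverseʳ (injective⇒permutation g _)))))
... | inj₁ f-inj | inj₂ cg     = ⊥-elim (let (i , j , i≢j , fi≡fj) = collision-≗ (sym ∘ f≗g) cg in i≢j (f-inj fi≡fj))
... | inj₂ cf    | inj₁ g-inj = ⊥-elim (let (i , j , i≢j , gi≡gj) = collision-≗ f≗g cf in i≢j (g-inj gi≡gj))
... | inj₂ _     | inj₂ _     = f≗g

invert-collision : (f : Fin n → Fin n) → Collision f → invert f ≗ f
invert-collision f (i , j , i≢j , fi≡fj) with injective-or-collision f
... | inj₁ inj = ⊥-elim (i≢j (inj fi≡fj))
... | inj₂ _   = λ _ → refl

invert-involutive : (f : Fin n → Fin n) → invert (invert f) ≗ f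
invert-involutive f with injective-or-collision f
... | inj₂ c   = invert-collision f c
... | inj₁ inj = inverse-of-inverse
  where
  π = injective⇒permutation f inj
  from-injective : Injective _≡_ _≡_ (π ⟨$⟩ˡ_)
  from-injective = ⟨$⟩ʳ-injective (flip π)
  inverse-of-inverse : invert (π ⟨$⟩ˡ_) ≗ f
  inverse-of-inverse with injective-or-collision (π ⟨$⟩ˡ_)
  ... | inj₁ from-inj = λ y →
    from-injective (trans (inverseʳ (injective⇒permutation (π ⟨$⟩ˡ_) from-inj)) (sym (inverseˡ π)))
  ... | inj₂ (i , j , i≢j , e) = ⊥-elim (i≢j (from-injective e))

term-invert : (M : Matrix n) (f : Fin n → Fin n) → term M (invert f) ≡ term (M ᵀ) f
term-invert M f with injective-or-collision f
... | inj₂ c   = trans (term-collision M c) (sym (term-collision (M ᵀ) c))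
... | inj₁ inj = cong₂ _*_ (sgnFun-inverse π)
  (trans (prodℤ-permute π _) (prodℤ-cong λ i → cong (M (f i)) (inverseˡ π)))
  where π = injective⇒permutation f inj

sumFuns-invert : (H : (Fin n → Fin n) → ℤ) → Extensional H → sumFuns (H ∘ invert) ≡ sumFuns H
sumFuns-invert = sumFuns-reindex invert invert invert-cong invert-cong invert-involutive invert-involutive

det-transpose : (M : Matrix n) → det (M ᵀ) ≡ det M
det-transpose {n} M = trans (sumOver-cong (allFuns n n) (λ f → sym (term-invert M f)))
                            (sumFuns-invert (term M) (term-extensional M))

i≡-i⇒i≡0 : ∀ x → x ≡ - x → x ≡ 0ℤ
i≡-i⇒i≡0 x x≡-x = ℤP.*-cancelˡ-≡ (+ 2) x 0ℤ (begin
  + 2 * x    ≡⟨ solve 1 (λ x → con (+ 2) :* x := x :+ x) refl x ⟩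
  x + x      ≡⟨ cong (_+_ x) x≡-x ⟩
  x + - x    ≡⟨ ℤP.+-inverseʳ x ⟩
  0ℤ         ∎)
  where open ≡-Reasoning

det-equal-rows : (M : Matrix n) {r k : Fin n} → r ≢ k → M r ≗ M k → det M ≡ 0ℤ
det-equal-rows {n} M {r} {k} r≢k Mr≗Mk = i≡-i⇒i≡0 (det M) (begin
  det M                         ≡⟨ sumFuns-reindex swap swap (λ e i → e _) (λ e i → e _)
                                     (λ f i → cong f (transpose-involutive r k i))
                                     (λ f i → cong f (transpose-involutive r k i))
                                     (term M) (term-extensional M) ⟨
  sumFuns (term M ∘ swap)       ≡⟨ sumOver-cong (allFuns n n) swap-term ⟩
  sumFuns (λ f → -1ℤ * term M f) ≡⟨ sumOver-*ˡ -1ℤ (term M) (allFuns n n) ⟩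
  -1ℤ * det M                   ≡⟨ ℤP.-1*i≡-i (det M) ⟩
  - det M                       ∎)
  where
  open ≡-Reasoning
  τ : Fin n → Fin n
  τ = PC.transpose r k
  swap : (Fin n → Fin n) → Fin n → Fin n
  swap f = f ∘ τ
  same-row : ∀ i → M (τ i) ≗ M i
  same-row i x = on (i ≟ r) (i ≟ k)
    where
    on : Dec (i ≡ r) → Dec (i ≡ k) → M (τ i) x ≡ M i x
    on (yes refl) _          = trans (cong (λ a → M a x) (transpose-matchˡ r k)) (sym (Mr≗Mk x))
    on (no _)     (yes refl) = trans (cong (λ a → M a x) (transpose-matchʳ r k)) (Mr≗Mk x)
    on (no i≢r)   (no i≢k)   = cong (λ a → M a x) (transpose-other i≢r i≢k)
  swap-term : ∀ f → term M (swap f) ≡ -1ℤ * term M f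
  swap-term f = begin
    sgnFun (f ∘ τ) * prodℤ (λ i → M i (f (τ i)))
      ≡⟨ cong₂ _*_ (sgnFun-∘ f (transpose r k)) (prodℤ-permute (transpose r k) _) ⟩
    sgnFun f * sgnFun τ * prodℤ (λ i → M (τ i) (f (τ (τ i))))
      ≡⟨ cong₂ (λ s p → sgnFun f * s * p) (sgnFun-transpose r≢k)
               (prodℤ-cong λ i → trans (cong (M (τ i) ∘ f) (transpose-involutive r k i)) (same-row i (f i))) ⟩
    sgnFun f * -1ℤ * prodℤ (λ i → M i (f i))
      ≡⟨ solve 2 (λ s p → s :* con -1ℤ :* p := con -1ℤ :* (s :* p)) refl (sgnFun f) (prodℤ (λ i → M i (f i))) ⟩
    -1ℤ * term M f ∎

prodℤ-linear : (r : Fin n) (c : ℤ) {w u v : Fin n → ℤ} →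
  (∀ i → i ≢ r → u i ≡ w i) → (∀ i → i ≢ r → v i ≡ w i) → w r ≡ u r + c * v r →
  prodℤ w ≡ prodℤ u + c * prodℤ v
prodℤ-linear {suc n} zero c {w} {u} {v} u≡w v≡w wr = begin
  w zero * prodℤ (w ∘ suc)
    ≡⟨ cong (_* prodℤ (w ∘ suc)) wr ⟩
  (u zero + c * v zero) * prodℤ (w ∘ suc)
    ≡⟨ solve 4 (λ a c b p → (a :+ c :* b) :* p := a :* p :+ c :* (b :* p)) refl (u zero) c (v zero) _ ⟩
  u zero * prodℤ (w ∘ suc) + c * (v zero * prodℤ (w ∘ suc))
    ≡⟨ cong₂ (λ p q → u zero * p + c * (v zero * q)) (prodℤ-cong λ i → sym (u≡w (suc i) λ ()))
                                                     (prodℤ-cong λ i → sym (v≡w (suc i) λ ())) ⟩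
  prodℤ u + c * prodℤ v ∎
  where open ≡-Reasoning
prodℤ-linear {suc n} (suc r) c {w} {u} {v} u≡w v≡w wr = begin
  w zero * prodℤ (w ∘ suc)
    ≡⟨ cong (w zero *_) (prodℤ-linear r c (λ i i≢r → u≡w (suc i) (i≢r ∘ FinP.suc-injective))
                                          (λ i i≢r → v≡w (suc i) (i≢r ∘ FinP.suc-injective)) wr) ⟩
  w zero * (prodℤ (u ∘ suc) + c * prodℤ (v ∘ suc))
    ≡⟨ solve 4 (λ a c p q → a :* (p :+ c :* q) := a :* p :+ c :* (a :* q)) refl (w zero) c _ _ ⟩
  w zero * prodℤ (u ∘ suc) + c * (w zero * prodℤ (v ∘ suc))
    ≡⟨ cong₂ (λ a b → a * prodℤ (u ∘ suc) + c * (b * prodℤ (v ∘ suc))) (sym (u≡w zero λ ())) (sym (v≡w zero λ ())) ⟩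
  prodℤ u + c * prodℤ v ∎
  where open ≡-Reasoning

det-row-linear : (r : Fin n) (c : ℤ) {M U V : Matrix n} →
  (∀ i → i ≢ r → U i ≗ M i) → (∀ i → i ≢ r → V i ≗ M i) → (∀ x → M r x ≡ U r x + c * V r x) →
  det M ≡ det U + c * det V
det-row-linear {n} r c {M} {U} {V} U≗M V≗M Mr = begin
  sumFuns (term M)
    ≡⟨ sumOver-cong (allFuns n n) split ⟩
  sumFuns (λ f → term U f + c * term V f)
    ≡⟨ sumOver-+ (term U) (λ f → c * term V f) (allFuns n n) ⟩
  det U + sumFuns (λ f → c * term V f)
    ≡⟨ cong (_+_ (det U)) (sumOver-*ˡ c (term V) (allFuns n n)) ⟩
  det U + c * det V ∎
  where
  open ≡-Reasoning
  split : ∀ f → term M f ≡ term U f + c * term V f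
  split f = begin
    sgnFun f * prodℤ (λ i → M i (f i))
      ≡⟨ cong (sgnFun f *_) (prodℤ-linear r c (λ i i≢r → U≗M i i≢r (f i)) (λ i i≢r → V≗M i i≢r (f i)) (Mr (f r))) ⟩
    sgnFun f * (prodℤ (λ i → U i (f i)) + c * prodℤ (λ i → V i (f i)))
      ≡⟨ solve 4 (λ s c p q → s :* (p :+ c :* q) := s :* p :+ c :* (s :* q)) refl (sgnFun f) c _ _ ⟩
    term U f + c * term V f ∎

det-add-row : {r k : Fin n} → r ≢ k → (c : ℤ) {M M′ : Matrix n} →
  (∀ i → i ≢ r → M′ i ≗ M i) → (∀ x → M′ r x ≡ M r x + c * M k x) → det M′ ≡ det M
det-add-row {n} {r} {k} r≢k c {M} {M′} M′≗M M′r = begin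
  det M′             ≡⟨ det-row-linear r c (λ i i≢r → sym ∘ M′≗M i i≢r)
                                          (λ i i≢r x → trans (V≗M i i≢r x) (sym (M′≗M i i≢r x)))
                                          (λ x → trans (M′r x) (cong (λ a → M r x + c * a) (sym (V-r x)))) ⟩
  det M + c * det V  ≡⟨ cong (λ d → det M + c * d) (det-equal-rows V r≢k (λ x → trans (V-r x) (sym (V≗M k (r≢k ∘ sym) x)))) ⟩
  det M + c * 0ℤ     ≡⟨ cong (_+_ (det M)) (ℤP.*-zeroʳ c) ⟩
  det M + 0ℤ         ≡⟨ ℤP.+-identityʳ (det M) ⟩
  det M              ∎
  where
  open ≡-Reasoning
  V : Matrix n
  V i with i ≟ r
  ... | yes _ = M k
  ... | no _  = M i
  V-r : V r ≗ M k
  V-r with r ≟ r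
  ... | yes _   = λ _ → refl
  ... | no r≢r  = ⊥-elim (r≢r refl)
  V≗M : ∀ i → i ≢ r → V i ≗ M i
  V≗M i i≢r with i ≟ r
  ... | yes i≡r = ⊥-elim (i≢r i≡r)
  ... | no _    = λ _ → refl

<ᵇ-suc : ∀ a t → a ≢ t → (a <ᵇ suc t) ≡ (a <ᵇ t)
<ᵇ-suc zero    zero    a≢t = ⊥-elim (a≢t refl)
<ᵇ-suc zero    (suc t) a≢t = refl
<ᵇ-suc (suc a) zero    a≢t = refl
<ᵇ-suc (suc a) (suc t) a≢t = <ᵇ-suc a t (a≢t ∘ cong suc)

toℕ-<ᵇ : (i : Fin n) → (toℕ i <ᵇ n) ≡ true
toℕ-<ᵇ zero    = refl
toℕ-<ᵇ (suc i) = toℕ-<ᵇ i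

addRowMultiples : Fin n → (Fin n → ℤ) → Matrix n → Matrix n
addRowMultiples k g M i x = M i x + g i * M k x

det-addRowMultiples-update : (k r : Fin n) {h h′ : Fin n → ℤ} → h k ≡ 0ℤ → h′ k ≡ 0ℤ →
  (∀ i → i ≢ r → h i ≡ h′ i) → (M : Matrix n) → det (addRowMultiples k h M) ≡ det (addRowMultiples k h′ M)
det-addRowMultiples-update k r {h} {h′} hk≡0 h′k≡0 h≡h′ M with r ≟ k
... | yes refl = det-cong λ i x → cong (λ a → M i x + a * M r x) (coefficient i (i ≟ r))
  where
  coefficient : ∀ i → Dec (i ≡ r) → h i ≡ h′ i
  coefficient i (yes refl) = trans hk≡0 (sym h′k≡0)
  coefficient i (no i≢r)   = h≡h′ i i≢r
... | no r≢k   =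
  det-add-row r≢k (h r - h′ r) (λ i i≢r x → cong (λ a → M i x + a * M k x) (h≡h′ i i≢r)) λ x → begin
  M r x + h r * M k x
    ≡⟨ solve 4 (λ a b c y → a :+ b :* y := a :+ c :* y :+ (b :- c) :* (y :+ con 0ℤ :* y)) refl (M r x) (h r) (h′ r) (M k x) ⟩
  M r x + h′ r * M k x + (h r - h′ r) * (M k x + 0ℤ * M k x)
    ≡⟨ cong (λ a → M r x + h′ r * M k x + (h r - h′ r) * (M k x + a * M k x)) h′k≡0 ⟨
  M r x + h′ r * M k x + (h r - h′ r) * (M k x + h′ k * M k x) ∎
  where open ≡-Reasoning

-- Induction on the number t of rows already modified, namely those of index < t.
det-addRowMultiples : (k : Fin n) (g : Fin n → ℤ) → g k ≡ 0ℤ → (M : Matrix n) →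
  det (addRowMultiples k g M) ≡ det M
det-addRowMultiples {n} k g gk≡0 M =
  trans (det-cong λ i x → cong (λ b → M i x + (if b then g i else 0ℤ) * M k x) (sym (toℕ-<ᵇ i)))
        (prefix n ℕP.≤-refl)
  where
  g↾ : ℕ → Fin n → ℤ
  g↾ t i = if toℕ i <ᵇ t then g i else 0ℤ
  g↾-k : ∀ t → g↾ t k ≡ 0ℤ
  g↾-k t with toℕ k <ᵇ t
  ... | true  = gk≡0
  ... | false = refl
  prefix : ∀ t → t ℕ.≤ n → det (addRowMultiples k (g↾ t) M) ≡ det M
  prefix zero    _   = det-cong λ i x → ℤP.+-identityʳ (M i x)
  prefix (suc t) t<n =
    trans (det-addRowMultiples-update k r (g↾-k (suc t)) (g↾-k t) unchanged M) (prefix t (ℕP.<⇒≤ t<n))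
    where
    r : Fin n
    r = Fin.fromℕ< t<n
    unchanged : ∀ i → i ≢ r → g↾ (suc t) i ≡ g↾ t i
    unchanged i i≢r = cong (λ b → if b then g i else 0ℤ)
      (<ᵇ-suc (toℕ i) t (λ e → i≢r (FinP.toℕ-injective (trans e (sym (FinP.toℕ-fromℕ< t<n))))))

addColMultiples : Fin n → (Fin n → ℤ) → Matrix n → Matrix n
addColMultiples k c M i j = M i j + c j * M i k

det-addColMultiples : (k : Fin n) (c : Fin n → ℤ) → c k ≡ 0ℤ → (M : Matrix n) →
  det (addColMultiples k c M) ≡ det M
det-addColMultiples k c ck≡0 M = begin
  det (addRowMultiples k c (M ᵀ) ᵀ)   ≡⟨ det-transpose (addRowMultiples k c (M ᵀ)) ⟩
  det (addRowMultiples k c (M ᵀ))     ≡⟨ det-addRowMultiples k c ck≡0 (M ᵀ) ⟩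
  det (M ᵀ)                           ≡⟨ det-transpose M ⟩
  det M                               ∎
  where open ≡-Reasoning

infix 4 _≡_mod_

record _≡_mod_ (a b : ℤ) (m : ℕ) : Set where
  constructor congruent
  field
    quotient : ℤ
    equality : a ≡ b + quotient * + m

≡⇒≡-mod : ∀ {a b m} → a ≡ b → a ≡ b mod m
≡⇒≡-mod {a} refl = congruent 0ℤ (sym (ℤP.+-identityʳ a))

≡-mod-sym : ∀ {a b m} → a ≡ b mod m → b ≡ a mod m
≡-mod-sym {a} {b} {m} (congruent q a≡) = congruent (- q) (begin
  b                         ≡⟨ solve 3 (λ b q m → b := b :+ q :* m :+ (:- q) :* m) refl b q (+ m) ⟩
  b + q * + m + - q * + m   ≡⟨ cong (λ x → x + - q * + m) a≡ ⟨
  a + - q * + m             ∎)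
  where open ≡-Reasoning

≡-mod-trans : ∀ {a b c m} → a ≡ b mod m → b ≡ c mod m → a ≡ c mod m
≡-mod-trans {a} {b} {c} {m} (congruent q a≡) (congruent r b≡) = congruent (r + q) (begin
  a                     ≡⟨ a≡ ⟩
  b + q * + m           ≡⟨ cong (λ x → x + q * + m) b≡ ⟩
  c + r * + m + q * + m ≡⟨ solve 4 (λ c r q m → c :+ r :* m :+ q :* m := c :+ (r :+ q) :* m) refl c r q (+ m) ⟩
  c + (r + q) * + m     ∎)
  where open ≡-Reasoning

+-cong-mod : ∀ {a a′ b b′ m} → a′ ≡ a mod m → b′ ≡ b mod m → a′ + b′ ≡ a + b mod m
+-cong-mod {a} {_} {b} {_} {m} (congruent q a′≡) (congruent r b′≡) =
  congruent (q + r) (trans (cong₂ _+_ a′≡ b′≡)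
  (solve 5 (λ a b q r m → a :+ q :* m :+ (b :+ r :* m) := a :+ b :+ (q :+ r) :* m) refl a b q r (+ m)))

*-cong-mod : ∀ {a a′ b b′ m} → a′ ≡ a mod m → b′ ≡ b mod m → a′ * b′ ≡ a * b mod m
*-cong-mod {a} {_} {b} {_} {m} (congruent q a′≡) (congruent r b′≡) =
  congruent (q * b + a * r + q * r * + m) (trans (cong₂ _*_ a′≡ b′≡)
  (solve 5 (λ a b q r m → (a :+ q :* m) :* (b :+ r :* m) := a :* b :+ (q :* b :+ a :* r :+ q :* r :* m) :* m)
         refl a b q r (+ m)))

neg-cong-mod : ∀ {a a′ m} → a′ ≡ a mod m → - a′ ≡ - a mod m
neg-cong-mod {a} {_} {m} (congruent q a′≡) =
  congruent (- q) (trans (cong -_ a′≡) (solve 3 (λ a q m → :- (a :+ q :* m) := :- a :+ (:- q) :* m) refl a q (+ m)))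

+-*-mod : ∀ a q m → a + q * + m ≡ a mod m
+-*-mod a q m = congruent q refl

neg-≡-mod-2 : ∀ x → - x ≡ x mod 2
neg-≡-mod-2 x = congruent (- x) (solve 1 (λ x → :- x := x :+ (:- x) :* con (+ 2)) refl x)

+-self-≡0-mod : ∀ {x} k → x ≡ 0ℤ mod k → x + x ≡ 0ℤ mod (2 ℕ.* k)
+-self-≡0-mod {x} k (congruent q x≡) = congruent q (begin
  x + x
    ≡⟨ cong₂ _+_ x≡ x≡ ⟩
  0ℤ + q * + k + (0ℤ + q * + k)
    ≡⟨ solve 2 (λ q k → con 0ℤ :+ q :* k :+ (con 0ℤ :+ q :* k) := con 0ℤ :+ q :* (con (+ 2) :* k)) refl q (+ k) ⟩
  0ℤ + q * (+ 2 * + k)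
    ≡⟨ cong (λ c → 0ℤ + q * c) (ℤP.pos-* 2 k) ⟨
  0ℤ + q * + (2 ℕ.* k) ∎)
  where open ≡-Reasoning

≡-mod⇒-≡0-mod : ∀ {a b m} → a ≡ b mod m → a - b ≡ 0ℤ mod m
≡-mod⇒-≡0-mod {a} {b} {m} (congruent q a≡) = congruent q (begin
  a - b                ≡⟨ cong (_- b) a≡ ⟩
  b + q * + m - b      ≡⟨ solve 3 (λ b q m → b :+ q :* m :- b := con 0ℤ :+ q :* m) refl b q (+ m) ⟩
  0ℤ + q * + m         ∎)
  where open ≡-Reasoning

-≡0-mod⇒≡-mod : ∀ {a b m} → a - b ≡ 0ℤ mod m → a ≡ b mod m
-≡0-mod⇒≡-mod {a} {b} {m} (congruent q a-b≡) = congruent q (begin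
  a                   ≡⟨ solve 2 (λ a b → a := b :+ (a :- b)) refl a b ⟩
  b + (a - b)         ≡⟨ cong (_+_ b) a-b≡ ⟩
  b + (0ℤ + q * + m)  ≡⟨ cong (_+_ b) (ℤP.+-identityˡ (q * + m)) ⟩
  b + q * + m         ∎)
  where open ≡-Reasoning

prodℤ-cong-mod : ∀ {m} {g′ g : Fin n → ℤ} → (∀ i → g′ i ≡ g i mod m) → prodℤ g′ ≡ prodℤ g mod m
prodℤ-cong-mod {zero}  e = ≡⇒≡-mod refl
prodℤ-cong-mod {suc n} e = *-cong-mod (e zero) (prodℤ-cong-mod (e ∘ suc))

sumOver-≡0-mod : ∀ {m} {F : E → ℤ} (xs : List E) → (∀ x → F x ≡ 0ℤ mod m) → sumOver F xs ≡ 0ℤ mod m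
sumOver-≡0-mod []       e = ≡⇒≡-mod refl
sumOver-≡0-mod (x ∷ xs) e = +-cong-mod (e x) (sumOver-≡0-mod xs e)

≡-mod-setoid : ℕ → Setoid _ _
≡-mod-setoid m = record
  { Carrier       = ℤ
  ; _≈_           = λ a b → a ≡ b mod m
  ; isEquivalence = record { refl = ≡⇒≡-mod refl ; sym = ≡-mod-sym ; trans = ≡-mod-trans }
  }

module ≡-mod-Reasoning (m : ℕ) = SetoidReasoning (≡-mod-setoid m)

residue-unique : ∀ {r s m} → r ℕ.< m → s ℕ.< m → + r ≡ + s mod m → r ≡ s
residue-unique {r} {s} {m} r<m s<m (congruent q r≡) = on q r≡
  where
  open ≡-Reasoning
  +-* : ∀ a t → + a + + suc t * + m ≡ + (a ℕ.+ suc t ℕ.* m)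
  +-* a t = trans (cong (_+_ (+ a)) (sym (ℤP.pos-* (suc t) m))) (sym (ℤP.pos-+ a _))
  below-m : ∀ {a b t} → a ℕ.< m → a ≢ b ℕ.+ suc t ℕ.* m
  below-m {a} {b} {t} a<m refl =
    ℕP.<-irrefl refl (ℕP.<-≤-trans a<m (ℕP.≤-trans (ℕP.m≤m+n m (t ℕ.* m)) (ℕP.m≤n+m _ b)))
  on : ∀ q → + r ≡ + s + q * + m → r ≡ s
  on (+ zero)     e = ℤP.+-injective (trans e (ℤP.+-identityʳ (+ s)))
  on (+ suc t)    e = ⊥-elim (below-m {b = s} {t} r<m (ℤP.+-injective (trans e (+-* s t))))
  on ℤ.-[1+ t ] e = ⊥-elim (below-m {b = r} {t} s<m (ℤP.+-injective (begin
    + s                                     ≡⟨ solve 3 (λ s t m → s := s :+ (:- t) :* m :+ t :* m) refl (+ s) (+ suc t) (+ m) ⟩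
    + s + ℤ.-[1+ t ] * + m + + suc t * + m  ≡⟨ cong (_+ + suc t * + m) e ⟨
    + r + + suc t * + m                     ≡⟨ +-* r t ⟩
    + (r ℕ.+ suc t ℕ.* m)                   ∎)))

≡-mod⇒%ℕ≡ : ∀ {a b m} .{{_ : ℕ.NonZero m}} → a ≡ b mod m → a ℤ.%ℕ m ≡ b ℤ.%ℕ m
≡-mod⇒%ℕ≡ {a} {b} {m} a≡b = residue-unique (ℤD.n%ℕd<d a m) (ℤD.n%ℕd<d b m) (begin
  + (a ℤ.%ℕ m)                       ≈⟨ +-*-mod (+ (a ℤ.%ℕ m)) (a ℤ./ℕ m) m ⟨
  + (a ℤ.%ℕ m) + a ℤ./ℕ m * + m       ≡⟨ ℤD.a≡a%ℕn+[a/ℕn]*n a m ⟨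
  a                                  ≈⟨ a≡b ⟩
  b                                  ≡⟨ ℤD.a≡a%ℕn+[a/ℕn]*n b m ⟩
  + (b ℤ.%ℕ m) + b ℤ./ℕ m * + m       ≈⟨ +-*-mod (+ (b ℤ.%ℕ m)) (b ℤ./ℕ m) m ⟩
  + (b ℤ.%ℕ m)                       ∎)
  where open ≡-mod-Reasoning m

-- Determinants of D-symmetric matrices modulo 4

DSymmetric : (Fin n → ℕ) → Matrix n → Set
DSymmetric d M = ∀ i j → + d i * M i j ≡ + d j * M j i

Positive : (Fin n → ℕ) → Set
Positive d = ∀ i → 0 ℕ.< d i

prodℤ-≢0 : {g : Fin n → ℤ} → (∀ i → g i ≢ 0ℤ) → prodℤ g ≢ 0ℤ
prodℤ-≢0 {zero}  g≢0 ()
prodℤ-≢0 {suc n} g≢0 e with ℤP.i*j≡0⇒i≡0∨j≡0 _ e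
... | inj₁ g₀≡0 = g≢0 zero g₀≡0
... | inj₂ p≡0  = prodℤ-≢0 (g≢0 ∘ suc) p≡0

positive-≢0 : ∀ {k} → 0 ℕ.< k → + k ≢ 0ℤ
positive-≢0 (ℕ.s≤s _) ()

prodℤ-transpose : (d : Fin n → ℕ) → Positive d → (M : Matrix n) → DSymmetric d M →
  (π : Permutation′ n) → prodℤ (λ i → M (π ⟨$⟩ʳ i) i) ≡ prodℤ (λ i → M i (π ⟨$⟩ʳ i))
prodℤ-transpose d d>0 M M-sym π = ℤP.*-cancelˡ-≡ D _ _ (begin
  D * prodℤ (λ i → M (π ⟨$⟩ʳ i) i)
    ≡⟨ cong (_* prodℤ (λ i → M (π ⟨$⟩ʳ i) i)) (prodℤ-permute π (λ i → + d i)) ⟩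
  prodℤ (λ i → + d (π ⟨$⟩ʳ i)) * prodℤ (λ i → M (π ⟨$⟩ʳ i) i)
    ≡⟨ prodℤ-* (λ i → + d (π ⟨$⟩ʳ i)) (λ i → M (π ⟨$⟩ʳ i) i) ⟨
  prodℤ (λ i → + d (π ⟨$⟩ʳ i) * M (π ⟨$⟩ʳ i) i)
    ≡⟨ prodℤ-cong (λ i → M-sym (π ⟨$⟩ʳ i) i) ⟩
  prodℤ (λ i → + d i * M i (π ⟨$⟩ʳ i))
    ≡⟨ prodℤ-* (λ i → + d i) (λ i → M i (π ⟨$⟩ʳ i)) ⟩
  D * prodℤ (λ i → M i (π ⟨$⟩ʳ i)) ∎)
  where
  open ≡-Reasoning
  D : ℤ
  D = prodℤ (λ i → + d i)
  instance
    D-nonZero : ℤ.NonZero D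
    D-nonZero = ℤ.≢-nonZero (prodℤ-≢0 (λ i → positive-≢0 (d>0 i)))

term-transpose : (d : Fin n → ℕ) → Positive d → (M : Matrix n) → DSymmetric d M →
  (f : Fin n → Fin n) → term (M ᵀ) f ≡ term M f
term-transpose d d>0 M M-sym f with injective-or-collision f
... | inj₁ inj = cong (sgnFun f *_) (prodℤ-transpose d d>0 M M-sym (injective⇒permutation f inj))
... | inj₂ c   = trans (term-collision (M ᵀ) c) (sym (term-collision M c))

-- A strict total order on maps, to pick one member of each orbit {f , Φ f} of size two.
module LexOrder (m N : ℕ) where

  open StrictTotalOrder (Lex.<-strictTotalOrder (FinP.<-strictTotalOrder N) m)
    using (compare) renaming (_<_ to _<ᵛ_; _<?_ to _<ᵛ?_)

  _<?_ : (f g : Fin m → Fin N) → Dec (Vec.tabulate f <ᵛ Vec.tabulate g)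
  f <? g = Vec.tabulate f <ᵛ? Vec.tabulate g

  <?-cong : {f f′ g g′ : Fin m → Fin N} → f ≗ f′ → g ≗ g′ → indicator (f <? g) ≡ indicator (f′ <? g′)
  <?-cong f≗f′ g≗g′ = indicator-cong (_ <? _) (_ <? _)
    (subst₂ _<ᵛ_ (VecP.tabulate-cong f≗f′) (VecP.tabulate-cong g≗g′))
    (subst₂ _<ᵛ_ (sym (VecP.tabulate-cong f≗f′)) (sym (VecP.tabulate-cong g≗g′)))

  trichotomy : (f g : Fin m → Fin N) → indicator (f <? g) + indicator (f ≟ᶠ g) + indicator (g <? f) ≡ 1ℤ
  trichotomy f g with compare (Vec.tabulate f) (Vec.tabulate g)
  ... | tri< _ f≉g g≮f rewrite dec-false (f ≟ᶠ g) (f≉g ∘ Pointwise.tabulate⁺) | dec-false (g <? f) g≮f = refl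
  ... | tri≈ _ f≈g g≮f rewrite dec-true (f ≟ᶠ g) (Pointwise.tabulate⁻ f≈g) | dec-false (g <? f) g≮f = refl
  ... | tri> _ f≉g g<f rewrite dec-false (f ≟ᶠ g) (f≉g ∘ Pointwise.tabulate⁺) | dec-true (g <? f) g<f = refl

-- The orbits of size two contribute even multiples of k.
sumFuns-involution : (Φ : (Fin m → Fin N) → Fin m → Fin N) →
  (∀ {f g} → f ≗ g → Φ f ≗ Φ g) → (∀ f → Φ (Φ f) ≗ f) →
  (X : (Fin m → Fin N) → ℤ) → Extensional X → (∀ f → X (Φ f) ≡ X f) →
  (k : ℕ) → (∀ f → X f ≡ 0ℤ mod k) →
  sumFuns X ≡ sumFuns (λ f → indicator (f ≟ᶠ Φ f) * X f) mod (2 ℕ.* k)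
sumFuns-involution {m} {N} Φ Φ-cong Φ-involutive X X-ext XΦ k X≡0 =
  subst (λ s → s ≡ sumFuns fixed mod (2 ℕ.* k)) (sym split)
        (≡-mod-trans (+-cong-mod (≡⇒≡-mod {sumFuns fixed} refl) (+-self-≡0-mod k below≡0))
                     (≡⇒≡-mod (ℤP.+-identityʳ (sumFuns fixed))))
  where
  open LexOrder m N
  below above fixed : (Fin m → Fin N) → ℤ
  below f = indicator (f <? Φ f) * X f
  above f = indicator (Φ f <? f) * X f
  fixed f = indicator (f ≟ᶠ Φ f) * X f
  below-ext : Extensional below
  below-ext f≗g = cong₂ _*_ (<?-cong f≗g (Φ-cong f≗g)) (X-ext f≗g)
  pointwise : ∀ f → X f ≡ fixed f + (below f + above f)
  pointwise f = begin
    X f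
      ≡⟨ ℤP.*-identityˡ (X f) ⟨
    1ℤ * X f
      ≡⟨ cong (_* X f) (trichotomy f (Φ f)) ⟨
    (indicator (f <? Φ f) + indicator (f ≟ᶠ Φ f) + indicator (Φ f <? f)) * X f
      ≡⟨ solve 4 (λ b e a x → (b :+ e :+ a) :* x := e :* x :+ (b :* x :+ a :* x)) refl
               (indicator (f <? Φ f)) (indicator (f ≟ᶠ Φ f)) (indicator (Φ f <? f)) (X f) ⟩
    fixed f + (below f + above f) ∎
    where open ≡-Reasoning
  above≡below : sumFuns above ≡ sumFuns below
  above≡below = trans (sumOver-cong (allFuns m N) λ f →
                        cong₂ _*_ (<?-cong (λ _ → refl) (λ i → sym (Φ-involutive f i))) (sym (XΦ f)))
                      (sumFuns-reindex Φ Φ Φ-cong Φ-cong Φ-involutive Φ-involutive below below-ext)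
  split : sumFuns X ≡ sumFuns fixed + (sumFuns below + sumFuns below)
  split = begin
    sumFuns X                                      ≡⟨ sumOver-cong (allFuns m N) pointwise ⟩
    sumFuns (λ f → fixed f + (below f + above f))   ≡⟨ sumOver-+ fixed _ (allFuns m N) ⟩
    sumFuns fixed + sumFuns (λ f → below f + above f) ≡⟨ cong (_+_ (sumFuns fixed)) (sumOver-+ below above (allFuns m N)) ⟩
    sumFuns fixed + (sumFuns below + sumFuns above) ≡⟨ cong (λ s → sumFuns fixed + (sumFuns below + s)) above≡below ⟩
    sumFuns fixed + (sumFuns below + sumFuns below) ∎
    where open ≡-Reasoning
  below≡0 : sumFuns below ≡ 0ℤ mod k
  below≡0 = sumOver-≡0-mod (allFuns m N) λ f →
    ≡-mod-trans (*-cong-mod (≡⇒≡-mod {indicator (f <? Φ f)} refl) (X≡0 f))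
                (≡⇒≡-mod (ℤP.*-zeroʳ (indicator (f <? Φ f))))

square≡0-mod-4 : ∀ z → z * z ≡ 0ℤ mod 4 → z ≡ 0ℤ mod 2
square≡0-mod-4 z (congruent t z²≡4t) = congruent (ℤ∣._∣_.quotient 2∣z)
  (trans (ℤ∣._∣_.equality 2∣z) (sym (ℤP.+-identityˡ (ℤ∣._∣_.quotient 2∣z * + 2))))
  where
  2∣∣z∣² : 2 ℕ∣.∣ ℤ.∣ z ∣ ℕ.* ℤ.∣ z ∣
  2∣∣z∣² = ℕ∣.divides (ℤ.∣ t ∣ ℕ.* 2) (begin
    ℤ.∣ z ∣ ℕ.* ℤ.∣ z ∣      ≡⟨ ℤP.abs-* z z ⟨
    ℤ.∣ z * z ∣             ≡⟨ cong ℤ.∣_∣ (trans z²≡4t (ℤP.+-identityˡ (t * + 4))) ⟩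
    ℤ.∣ t * + 4 ∣           ≡⟨ ℤP.abs-* t (+ 4) ⟩
    ℤ.∣ t ∣ ℕ.* 4           ≡⟨ ℕP.*-assoc ℤ.∣ t ∣ 2 2 ⟨
    ℤ.∣ t ∣ ℕ.* 2 ℕ.* 2     ∎)
    where open ≡-Reasoning
  2∣z : + 2 ℤ∣.∣ z
  2∣z with euclidsLemma ℤ.∣ z ∣ ℤ.∣ z ∣ (from-yes (prime? 2)) 2∣∣z∣²
  ... | inj₁ 2∣∣z∣ = ℤ∣.∣ᵤ⇒∣ 2∣∣z∣
  ... | inj₂ 2∣∣z∣ = ℤ∣.∣ᵤ⇒∣ 2∣∣z∣

-- For z = x b + y a, p z = 2 q y b and q z = 2 p x a, so p q z² = 4 p q (y b)(x a).
cross-term-even : (p q : ℕ) → 0 ℕ.< p → 0 ℕ.< q → {a b x y : ℤ} →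
  + p * a ≡ + q * b → + p * x ≡ + q * y → x * b + y * a ≡ 0ℤ mod 2
cross-term-even p q p>0 q>0 {a} {b} {x} {y} pa≡qb px≡qy = square≡0-mod-4 z (congruent (y * b * (x * a))
  (trans (ℤP.*-cancelˡ-≡ (P * Q) (z * z) (y * b * (x * a) * + 4) (begin
    P * Q * (z * z)
      ≡⟨ solve 3 (λ P Q z → P :* Q :* (z :* z) := (P :* z) :* (Q :* z)) refl P Q z ⟩
    (P * z) * (Q * z)
      ≡⟨ cong₂ _*_ pz qz ⟩
    + 2 * (Q * (y * b)) * (+ 2 * (P * (x * a)))
      ≡⟨ solve 4 (λ P Q u v → con (+ 2) :* (Q :* u) :* (con (+ 2) :* (P :* v))
          := P :* Q :* (u :* v :* con (+ 4))) refl P Q (y * b) (x * a) ⟩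
    P * Q * (y * b * (x * a) * + 4)               ∎))
  (sym (ℤP.+-identityˡ (y * b * (x * a) * + 4)))))
  where
  open ≡-Reasoning
  P Q z : ℤ
  P = + p
  Q = + q
  z = x * b + y * a
  pz : P * z ≡ + 2 * (Q * (y * b))
  pz = begin
    P * (x * b + y * a)
      ≡⟨ solve 5 (λ P x b y a → P :* (x :* b :+ y :* a) := (P :* x) :* b :+ (P :* a) :* y) refl P x b y a ⟩
    P * x * b + P * a * y
      ≡⟨ cong₂ (λ c e → c * b + e * y) px≡qy pa≡qb ⟩
    Q * y * b + Q * b * y
      ≡⟨ solve 3 (λ Q y b → Q :* y :* b :+ Q :* b :* y := con (+ 2) :* (Q :* (y :* b))) refl Q y b ⟩
    + 2 * (Q * (y * b))       ∎
  qz : Q * z ≡ + 2 * (P * (x * a))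
  qz = begin
    Q * (x * b + y * a)
      ≡⟨ solve 5 (λ Q x b y a → Q :* (x :* b :+ y :* a) := x :* (Q :* b) :+ (Q :* y) :* a) refl Q x b y a ⟩
    x * (Q * b) + Q * y * a
      ≡⟨ cong₂ (λ c e → x * c + e * a) pa≡qb px≡qy ⟨
    x * (P * a) + P * x * a
      ≡⟨ solve 3 (λ P x a → x :* (P :* a) :+ P :* x :* a := con (+ 2) :* (P :* (x :* a))) refl P x a ⟩
    + 2 * (P * (x * a))       ∎
  instance
    PQ-nonZero : ℤ.NonZero (P * Q)
    PQ-nonZero = ℤP.i*j≢0 P Q {{ℤ.≢-nonZero (positive-≢0 p>0)}} {{ℤ.≢-nonZero (positive-≢0 q>0)}}

pair-≡-mod-4 : (p q : ℕ) → 0 ℕ.< p → 0 ℕ.< q → {a b a′ b′ : ℤ} →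
  + p * a ≡ + q * b → + p * a′ ≡ + q * b′ → a′ ≡ a mod 2 → b′ ≡ b mod 2 → a′ * b′ ≡ a * b mod 4
pair-≡-mod-4 p q p>0 q>0 {a} {b} {a′} {b′} pa≡qb pa′≡qb′ (congruent x a′≡) (congruent y b′≡) =
  congruent (w + x * y) (begin
    a′ * b′
      ≡⟨ cong₂ _*_ a′≡ b′≡ ⟩
    (a + x * + 2) * (b + y * + 2)
      ≡⟨ solve 4 (λ a b x y → (a :+ x :* con (+ 2)) :* (b :+ y :* con (+ 2))
          := a :* b :+ (x :* b :+ y :* a) :* con (+ 2) :+ x :* y :* con (+ 4)) refl a b x y ⟩
    a * b + (x * b + y * a) * + 2 + x * y * + 4
      ≡⟨ cong (λ c → a * b + c * + 2 + x * y * + 4) (trans z≡2w (ℤP.+-identityˡ (w * + 2))) ⟩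
    a * b + w * + 2 * + 2 + x * y * + 4
      ≡⟨ solve 4 (λ ab w x y → ab :+ w :* con (+ 2) :* con (+ 2) :+ x :* y :* con (+ 4)
          := ab :+ (w :+ x :* y) :* con (+ 4)) refl (a * b) w x y ⟩
    a * b + (w + x * y) * + 4                ∎)
  where
  open ≡-Reasoning
  open GroupProperties (AbelianGroup.group ℤP.+-0-abelianGroup) using () renaming (∙-cancelˡ to +-cancelˡ)
  P Q : ℤ
  P = + p
  Q = + q
  px≡qy : P * x ≡ Q * y
  px≡qy = ℤP.*-cancelˡ-≡ (+ 2) (P * x) (Q * y) (+-cancelˡ (P * a) (+ 2 * (P * x)) (+ 2 * (Q * y)) (begin
    P * a + + 2 * (P * x)
      ≡⟨ solve 3 (λ P a x → P :* a :+ con (+ 2) :* (P :* x) := P :* (a :+ x :* con (+ 2))) refl P a x ⟩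
    P * (a + x * + 2)
      ≡⟨ cong (P *_) a′≡ ⟨
    P * a′
      ≡⟨ pa′≡qb′ ⟩
    Q * b′
      ≡⟨ cong (Q *_) b′≡ ⟩
    Q * (b + y * + 2)
      ≡⟨ solve 3 (λ Q b y → Q :* (b :+ y :* con (+ 2)) := Q :* b :+ con (+ 2) :* (Q :* y)) refl Q b y ⟩
    Q * b + + 2 * (Q * y)
      ≡⟨ cong (λ c → c + + 2 * (Q * y)) pa≡qb ⟨
    P * a + + 2 * (Q * y)     ∎))
  w : ℤ
  w = _≡_mod_.quotient (cross-term-even p q p>0 q>0 pa≡qb px≡qy)
  z≡2w : x * b + y * a ≡ 0ℤ + w * + 2
  z≡2w = _≡_mod_.equality (cross-term-even p q p>0 q>0 pa≡qb px≡qy)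

-- Each 2-cycle {i , f i} of an involution f contributes a_{i,f i} a_{f i,i} at its smaller index.
pairFactor : Matrix n → (Fin n → Fin n) → Fin n → ℤ
pairFactor M f i = if i <ᶠ f i then M i (f i) * M (f i) i else (if f i <ᶠ i then 1ℤ else M i (f i))

prodℤ-involution : (M : Matrix n) (f : Fin n → Fin n) → (∀ i → f (f i) ≡ i) →
  prodℤ (λ i → M i (f i)) ≡ prodℤ (pairFactor M f)
prodℤ-involution {n} M f f²≡id = begin
  prodℤ (λ i → M i (f i))                             ≡⟨ prodℤ-cong split ⟩
  prodℤ (λ i → upper i * (lower i * diagonal i))      ≡⟨ prodℤ-* upper _ ⟩
  prodℤ upper * prodℤ (λ i → lower i * diagonal i)    ≡⟨ cong (prodℤ upper *_) (prodℤ-* lower diagonal) ⟩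
  prodℤ upper * (prodℤ lower * prodℤ diagonal)        ≡⟨ cong (λ l → prodℤ upper * (l * prodℤ diagonal)) lower≡upper′ ⟩
  prodℤ upper * (prodℤ upper′ * prodℤ diagonal)       ≡⟨ cong (prodℤ upper *_) (prodℤ-* upper′ diagonal) ⟨
  prodℤ upper * prodℤ (λ i → upper′ i * diagonal i)   ≡⟨ prodℤ-* upper _ ⟨
  prodℤ (λ i → upper i * (upper′ i * diagonal i))     ≡⟨ prodℤ-cong merge ⟩
  prodℤ (pairFactor M f)                              ∎
  where
  open ≡-Reasoning
  upper upper′ lower diagonal : Fin n → ℤ
  upper i    = if i <ᶠ f i then M i (f i) else 1ℤ
  upper′ i   = if i <ᶠ f i then M (f i) i else 1ℤ
  lower i    = if f i <ᶠ i then M i (f i) else 1ℤ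
  diagonal i = if i <ᶠ f i then 1ℤ else (if f i <ᶠ i then 1ℤ else M i (f i))
  split : ∀ i → M i (f i) ≡ upper i * (lower i * diagonal i)
  split i with i <ᶠ f i in i<fi | f i <ᶠ i in fi<i
  ... | true  | true  with () ← trans (sym (<ᶠ-asym {i = i} {f i} i<fi)) fi<i
  ... | true  | false = sym (trans (cong (M i (f i) *_) (ℤP.*-identityˡ 1ℤ)) (ℤP.*-identityʳ _))
  ... | false | true  = sym (trans (ℤP.*-identityˡ _) (ℤP.*-identityʳ _))
  ... | false | false = sym (trans (ℤP.*-identityˡ _) (ℤP.*-identityˡ _))
  lower≡upper′ : prodℤ lower ≡ prodℤ upper′
  lower≡upper′ = trans (prodℤ-permute (permutation f f f²≡id f²≡id) lower)
    (prodℤ-cong λ i → cong₂ (λ a b → if a <ᶠ f i then M (f i) b else 1ℤ) (f²≡id i) (f²≡id i))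
  merge : ∀ i → upper i * (upper′ i * diagonal i) ≡ pairFactor M f i
  merge i with i <ᶠ f i
  ... | true  = cong (M i (f i) *_) (ℤP.*-identityʳ (M (f i) i))
  ... | false = trans (ℤP.*-identityˡ _) (ℤP.*-identityˡ _)

pairFactor-≡-mod-4 : (d : Fin n → ℕ) → Positive d → (M M′ : Matrix n) → DSymmetric d M → DSymmetric d M′ →
  (∀ i j → M′ i j ≡ M i j mod 2) → (∀ i → M′ i i ≡ M i i mod 4) →
  (f : Fin n → Fin n) (i : Fin n) → pairFactor M′ f i ≡ pairFactor M f i mod 4
pairFactor-≡-mod-4 d d>0 M M′ M-sym M′-sym M′≡M diag f i with i <ᶠ f i in i<fi | f i <ᶠ i in fi<i
... | true  | _     = pair-≡-mod-4 (d i) (d (f i)) (d>0 i) (d>0 (f i)) (M-sym i (f i)) (M′-sym i (f i))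
                                   (M′≡M i (f i)) (M′≡M (f i) i)
... | false | true  = ≡⇒≡-mod refl
... | false | false = subst (λ j → M′ i j ≡ M i j mod 4) (<ᶠ-connex i<fi fi<i) (diag i)

term-cong-mod : ∀ {m} {M M′ : Matrix n} → (∀ i j → M′ i j ≡ M i j mod m) → ∀ f → term M′ f ≡ term M f mod m
term-cong-mod M′≡M f = *-cong-mod (≡⇒≡-mod {sgnFun f} refl) (prodℤ-cong-mod λ i → M′≡M i (f i))

term-invert-dsym : (d : Fin n → ℕ) → Positive d → (M : Matrix n) → DSymmetric d M →
  ∀ f → term M (invert f) ≡ term M f
term-invert-dsym d d>0 M M-sym f = trans (term-invert M f) (term-transpose d d>0 M M-sym f)

term-involution-≡-mod-4 : (d : Fin n → ℕ) → Positive d → (M M′ : Matrix n) → DSymmetric d M → DSymmetric d M′ →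
  (∀ i j → M′ i j ≡ M i j mod 2) → (∀ i → M′ i i ≡ M i i mod 4) →
  ∀ f → f ≗ invert f → term M′ f ≡ term M f mod 4
term-involution-≡-mod-4 d d>0 M M′ M-sym M′-sym M′≡M diag f f≗f⁻¹ with injective-or-collision f
... | inj₂ c   = ≡⇒≡-mod (trans (term-collision M′ c) (sym (term-collision M c)))
... | inj₁ inj = *-cong-mod (≡⇒≡-mod {sgnFun f} refl)
  (subst₂ (λ P′ P → P′ ≡ P mod 4) (sym (prodℤ-involution M′ f f²≡id)) (sym (prodℤ-involution M f f²≡id))
          (prodℤ-cong-mod (pairFactor-≡-mod-4 d d>0 M M′ M-sym M′-sym M′≡M diag f)))
  where
  f²≡id : ∀ i → f (f i) ≡ i
  f²≡id i = trans (cong f (f≗f⁻¹ i)) (inverseʳ (injective⇒permutation f inj))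

det-≡-mod-4 : (d : Fin n → ℕ) → Positive d → (M M′ : Matrix n) → DSymmetric d M → DSymmetric d M′ →
  (∀ i j → M′ i j ≡ M i j mod 2) → (∀ i → M′ i i ≡ M i i mod 4) → det M′ ≡ det M mod 4
det-≡-mod-4 {n} d d>0 M M′ M-sym M′-sym M′≡M diag = -≡0-mod⇒≡-mod (subst (_≡ 0ℤ mod 4) sum-X
  (≡-mod-trans (sumFuns-involution invert invert-cong invert-involutive X X-ext X-invert 2 X-even)
               (sumOver-≡0-mod (allFuns n n) fixed-term)))
  where
  X : (Fin n → Fin n) → ℤ
  X f = term M′ f - term M f
  X-ext : Extensional X
  X-ext f≗g = cong₂ _-_ (term-extensional M′ f≗g) (term-extensional M f≗g)
  X-invert : ∀ f → X (invert f) ≡ X f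
  X-invert f = cong₂ _-_ (term-invert-dsym d d>0 M′ M′-sym f) (term-invert-dsym d d>0 M M-sym f)
  X-even : ∀ f → X f ≡ 0ℤ mod 2
  X-even f = ≡-mod⇒-≡0-mod (term-cong-mod M′≡M f)
  fixed-term : ∀ f → indicator (f ≟ᶠ invert f) * X f ≡ 0ℤ mod 4
  fixed-term f = on (f ≟ᶠ invert f)
    where
    on : (e : Dec (f ≗ invert f)) → indicator e * X f ≡ 0ℤ mod 4
    on (yes f≗f⁻¹) = subst (_≡ 0ℤ mod 4) (sym (ℤP.*-identityˡ (X f)))
                           (≡-mod⇒-≡0-mod (term-involution-≡-mod-4 d d>0 M M′ M-sym M′-sym M′≡M diag f f≗f⁻¹))
    on (no _)      = ≡⇒≡-mod refl
  sum-X : sumFuns X ≡ det M′ - det M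
  sum-X = trans (sumOver-+ (term M′) (λ f → - term M f) (allFuns n n))
    (cong (_+_ (det M′)) (trans (sumOver-cong (allFuns n n) λ f → sym (ℤP.-1*i≡-i (term M f)))
                         (trans (sumOver-*ˡ -1ℤ (term M) (allFuns n n)) (ℤP.-1*i≡-i (det M)))))

-- The quasi-Cartan companion

SkewSymmetrizer : (Fin n → ℕ) → Matrix n → Set
SkewSymmetrizer d B = ∀ i j → + d i * B i j ≡ - (+ d j * B j i)

sgn-positive-* : ∀ k x → 0 ℕ.< k → sgn (+ k * x) ≡ sgn x
sgn-positive-* (suc k) (+ zero)    _ = cong sgn (ℤP.*-zeroʳ (+ suc k))
sgn-positive-* (suc k) (+ suc _)   _ = refl
sgn-positive-* (suc k) ℤ.-[1+ _ ] _ = refl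

skew-sgn : (d : Fin n → ℕ) → Positive d → (B : Matrix n) → SkewSymmetrizer d B →
  ∀ i j → sgn (B j i) ≡ - sgn (B i j)
skew-sgn d d>0 B B-skew i j = begin
  sgn (B j i)                   ≡⟨ sgn-positive-* (d j) (B j i) (d>0 j) ⟨
  sgn (+ d j * B j i)           ≡⟨ cong sgn (ℤP.neg-involutive _) ⟨
  sgn (- - (+ d j * B j i))     ≡⟨ cong (sgn ∘ -_) (B-skew i j) ⟨
  sgn (- (+ d i * B i j))       ≡⟨ sgn-neg _ ⟩
  - sgn (+ d i * B i j)         ≡⟨ cong -_ (sgn-positive-* (d i) (B i j) (d>0 i)) ⟩
  - sgn (B i j)                 ∎
  where open ≡-Reasoning

skew-diagonal : (d : Fin n → ℕ) → Positive d → (B : Matrix n) → SkewSymmetrizer d B → ∀ i → B i i ≡ 0ℤ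
skew-diagonal d d>0 B B-skew i = ℤP.*-cancelˡ-≡ (+ d i) (B i i) 0ℤ {{ℤ.≢-nonZero (positive-≢0 (d>0 i))}}
  (trans (i≡-i⇒i≡0 (+ d i * B i i) (B-skew i i)) (sym (ℤP.*-zeroʳ (+ d i))))

quasiCartan : Matrix n → Matrix n
quasiCartan B i j with i ≟ j
... | yes _ = + 2
... | no _  = if i <ᶠ j then B i j else - B i j

quasiCartan-diagonal : (B : Matrix n) (i : Fin n) → quasiCartan B i i ≡ + 2
quasiCartan-diagonal B i with i ≟ i
... | yes _   = refl
... | no i≢i  = ⊥-elim (i≢i refl)

quasiCartan-off : (B : Matrix n) {i j : Fin n} → i ≢ j → quasiCartan B i j ≡ (if i <ᶠ j then B i j else - B i j)
quasiCartan-off B {i} {j} i≢j with i ≟ j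
... | yes i≡j = ⊥-elim (i≢j i≡j)
... | no _    = refl

quasiCartan-≡-mod-2 : (B : Matrix n) → (∀ i → B i i ≡ 0ℤ) → ∀ i j → quasiCartan B i j ≡ B i j mod 2
quasiCartan-≡-mod-2 B B-diag i j = on (i ≟ j)
  where
  on : Dec (i ≡ j) → quasiCartan B i j ≡ B i j mod 2
  on (yes refl) = congruent 1ℤ (trans (quasiCartan-diagonal B i) (cong (λ b → b + 1ℤ * + 2) (sym (B-diag i))))
  on (no i≢j) rewrite quasiCartan-off B i≢j with i <ᶠ j
  ... | true  = ≡⇒≡-mod refl
  ... | false = neg-≡-mod-2 (B i j)

quasiCartan-dsym : (d : Fin n → ℕ) (B : Matrix n) → SkewSymmetrizer d B → DSymmetric d (quasiCartan B)
quasiCartan-dsym d B B-skew i j = on (i ≟ j)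
  where
  on : Dec (i ≡ j) → + d i * quasiCartan B i j ≡ + d j * quasiCartan B j i
  on (yes refl) = refl
  on (no i≢j) rewrite quasiCartan-off B i≢j | quasiCartan-off B (i≢j ∘ sym) | <ᶠ-flip i≢j with i <ᶠ j
  ... | true  = trans (B-skew i j) (ℤP.neg-distribʳ-* (+ d j) (B j i))
  ... | false = trans (sym (ℤP.neg-distribʳ-* (+ d i) (B i j))) (sym (B-skew j i))

isqrtFrom-exact : ∀ m k p → p ℕ.* p ℕ.≤ m → m ℕ.< suc p ℕ.* suc p → p ℕ.≤ k → isqrtFrom m k ≡ p
isqrtFrom-exact m zero    zero _  _  _   = refl
isqrtFrom-exact m (suc k) p   lo hi p≤k with suc k ℕ.* suc k ℕ.≤ᵇ m in test | ℕP.m≤n⇒m<n∨m≡n p≤k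
... | true  | inj₂ refl            = refl
... | false | inj₂ refl            with () ← subst T test (ℕP.≤⇒≤ᵇ lo)
... | false | inj₁ (ℕ.s≤s p≤k′) = isqrtFrom-exact m k p lo hi p≤k′
... | true  | inj₁ (ℕ.s≤s p≤k′) = ⊥-elim (ℕP.<-irrefl refl (ℕP.<-≤-trans hi
  (ℕP.≤-trans (ℕP.*-mono-≤ (ℕ.s≤s p≤k′) (ℕ.s≤s p≤k′)) (ℕP.≤ᵇ⇒≤ (suc k ℕ.* suc k) m (subst T (sym test) _)))))

isqrt-square : ∀ p → isqrt (p ℕ.* p) ≡ p
isqrt-square zero    = refl
isqrt-square (suc p) = isqrtFrom-exact (suc p ℕ.* suc p) (suc p ℕ.* suc p) (suc p) ℕP.≤-refl
  (ℕP.*-mono-< (ℕP.n<1+n (suc p)) (ℕP.n<1+n (suc p))) (ℕP.m≤m*n (suc p) (suc p))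

∣∣-dsym : (d : Fin n → ℕ) (M : Matrix n) → DSymmetric d M → DSymmetric d (λ i j → + ℤ.∣ M i j ∣)
∣∣-dsym d M M-sym i j = begin
  + d i * + ℤ.∣ M i j ∣       ≡⟨ ℤP.pos-* (d i) ℤ.∣ M i j ∣ ⟨
  + (d i ℕ.* ℤ.∣ M i j ∣)     ≡⟨ cong +_ (ℤP.abs-* (+ d i) (M i j)) ⟨
  + ℤ.∣ + d i * M i j ∣       ≡⟨ cong (+_ ∘ ℤ.∣_∣) (M-sym i j) ⟩
  + ℤ.∣ + d j * M j i ∣       ≡⟨ cong +_ (ℤP.abs-* (+ d j) (M j i)) ⟩
  + (d j ℕ.* ℤ.∣ M j i ∣)     ≡⟨ ℤP.pos-* (d j) ℤ.∣ M j i ∣ ⟩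
  + d j * + ℤ.∣ M j i ∣       ∎
  where open ≡-Reasoning

symSq-∣quasiCartan∣ : (B : Matrix n) (i j : Fin n) →
  symSq B i j ≡ ℤ.∣ quasiCartan B i j ∣ ℕ.* ℤ.∣ quasiCartan B j i ∣
symSq-∣quasiCartan∣ B i j with i ≟ j
... | yes refl rewrite quasiCartan-diagonal B i = refl
... | no i≢j rewrite quasiCartan-off B (i≢j ∘ sym) | <ᶠ-flip i≢j with i <ᶠ j
...   | true  = trans (ℤP.abs-* (B i j) (B j i)) (cong (ℤ.∣ B i j ∣ ℕ.*_) (sym (ℤP.∣-i∣≡∣i∣ (B j i))))
...   | false = trans (ℤP.abs-* (B i j) (B j i)) (cong (ℕ._* ℤ.∣ B j i ∣) (sym (ℤP.∣-i∣≡∣i∣ (B i j))))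

sgn-*-∣∣ : ∀ x → sgn x * + ℤ.∣ x ∣ ≡ x
sgn-*-∣∣ (+ zero)    = refl
sgn-*-∣∣ (+ suc n)   = ℤP.*-identityˡ (+ suc n)
sgn-*-∣∣ ℤ.-[1+ n ] = ℤP.-1*i≡-i (+ suc n)

symSign-*-∣quasiCartan∣ : (d : Fin n → ℕ) → Positive d → (B : Matrix n) → SkewSymmetrizer d B →
  ∀ i j → symSign B i j * + ℤ.∣ quasiCartan B i j ∣ ≡ quasiCartan B i j
symSign-*-∣quasiCartan∣ d d>0 B B-skew i j with i ≟ j
... | yes refl = refl
... | no i≢j with i <ᶠ j
...   | true  = sgn-*-∣∣ (B i j)
...   | false = begin
  sgn (B j i) * + ℤ.∣ - B i j ∣    ≡⟨ cong₂ (λ s a → s * + a) (skew-sgn d d>0 B B-skew i j) (ℤP.∣-i∣≡∣i∣ (B i j)) ⟩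
  - sgn (B i j) * + ℤ.∣ B i j ∣    ≡⟨ ℤP.neg-distribˡ-* (sgn (B i j)) _ ⟨
  - (sgn (B i j) * + ℤ.∣ B i j ∣)  ≡⟨ cong -_ (sgn-*-∣∣ (B i j)) ⟩
  - B i j                          ∎
  where open ≡-Reasoning

-- For a bijection f the radicand is the square (∏ᵢ |a_i,f(i)|)², as D-symmetry of |A| gives
-- ∏ᵢ |a_f(i),i| = ∏ᵢ |a_i,f(i)|.
symmetrization-term : (d : Fin n → ℕ) → Positive d → (B : Matrix n) → SkewSymmetrizer d B → (f : Fin n → Fin n) →
  sgnFun f * prodℤ (λ i → symSign B i (f i)) * + isqrt (prodℕ (λ i → symSq B i (f i))) ≡ term (quasiCartan B) f
symmetrization-term {n} d d>0 B B-skew f with injective-or-collision f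
... | inj₂ (i , j , i≢j , fi≡fj) rewrite sgnFun-collision f i≢j fi≡fj = refl
... | inj₁ inj = begin
  sgnFun f * prodℤ σ * + isqrt (prodℕ (λ i → symSq B i (f i)))
    ≡⟨ cong (λ r → sgnFun f * prodℤ σ * + isqrt r) radicand ⟩
  sgnFun f * prodℤ σ * + isqrt (p ℕ.* p)
    ≡⟨ cong (λ r → sgnFun f * prodℤ σ * + r) (isqrt-square p) ⟩
  sgnFun f * prodℤ σ * + p
    ≡⟨ ℤP.*-assoc (sgnFun f) (prodℤ σ) (+ p) ⟩
  sgnFun f * (prodℤ σ * + p)
    ≡⟨ cong (λ q → sgnFun f * (prodℤ σ * q)) (+-prodℕ ∣A∣f) ⟩
  sgnFun f * (prodℤ σ * prodℤ (λ i → + ∣A∣f i))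
    ≡⟨ cong (sgnFun f *_) (prodℤ-* σ (λ i → + ∣A∣f i)) ⟨
  sgnFun f * prodℤ (λ i → σ i * + ∣A∣f i)
    ≡⟨ cong (sgnFun f *_) (prodℤ-cong λ i → symSign-*-∣quasiCartan∣ d d>0 B B-skew i (f i)) ⟩
  term A f                                                        ∎
  where
  open ≡-Reasoning
  A : Matrix n
  A = quasiCartan B
  σ : Fin n → ℤ
  σ i = symSign B i (f i)
  ∣A∣f : Fin n → ℕ
  ∣A∣f i = ℤ.∣ A i (f i) ∣
  p : ℕ
  p = prodℕ ∣A∣f
  radicand : prodℕ (λ i → symSq B i (f i)) ≡ p ℕ.* p
  radicand = ℤP.+-injective (begin
    + prodℕ (λ i → symSq B i (f i))
      ≡⟨ +-prodℕ (λ i → symSq B i (f i)) ⟩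
    prodℤ (λ i → + symSq B i (f i))
      ≡⟨ prodℤ-cong (λ i → trans (cong +_ (symSq-∣quasiCartan∣ B i (f i)))
          (ℤP.pos-* (∣A∣f i) ℤ.∣ A (f i) i ∣)) ⟩
    prodℤ (λ i → + ∣A∣f i * + ℤ.∣ A (f i) i ∣)
      ≡⟨ prodℤ-* (λ i → + ∣A∣f i) (λ i → + ℤ.∣ A (f i) i ∣) ⟩
    prodℤ (λ i → + ∣A∣f i) * prodℤ (λ i → + ℤ.∣ A (f i) i ∣)
      ≡⟨ cong (prodℤ (λ i → + ∣A∣f i) *_)
          (prodℤ-transpose d d>0 (λ i j → + ℤ.∣ A i j ∣)
          (∣∣-dsym d A (quasiCartan-dsym d B B-skew))
          (injective⇒permutation f inj)) ⟩
    prodℤ (λ i → + ∣A∣f i) * prodℤ (λ i → + ∣A∣f i)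
      ≡⟨ cong₂ _*_ (+-prodℕ ∣A∣f) (+-prodℕ ∣A∣f) ⟨
    + p * + p
      ≡⟨ ℤP.pos-* p p ⟨
    + (p ℕ.* p)                                               ∎)

detSym≡det-quasiCartan : (B : Matrix n) → SkewSymmetrizable B → detSym B ≡ det (quasiCartan B)
detSym≡det-quasiCartan {n} B (d , d>0 , B-skew) = sumOver-cong (allFuns n n) (symmetrization-term d d>0 B B-skew)

-- Mutation

isPositive : ℤ → ℤ
isPositive (+ suc _) = 1ℤ
isPositive _         = 0ℤ

pos≡isPositive* : ∀ x → pos x ≡ isPositive x * x
pos≡isPositive* (+ zero)    = refl
pos≡isPositive* (+ suc n)   = sym (ℤP.*-identityˡ (+ suc n))
pos≡isPositive* ℤ.-[1+ n ] = refl

isPositive-sgn : ∀ x y → sgn x ≡ sgn y → isPositive x ≡ isPositive y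
isPositive-sgn (+ zero)    (+ zero)    _ = refl
isPositive-sgn (+ zero)    ℤ.-[1+ _ ] _ = refl
isPositive-sgn (+ suc _)   (+ suc _)   _ = refl
isPositive-sgn ℤ.-[1+ _ ] (+ zero)    _ = refl
isPositive-sgn ℤ.-[1+ _ ] ℤ.-[1+ _ ] _ = refl

isPositive-idempotent : ∀ x → isPositive x * isPositive x ≡ isPositive x
isPositive-idempotent (+ zero)    = refl
isPositive-idempotent (+ suc _)   = refl
isPositive-idempotent ℤ.-[1+ _ ] = refl

*-pos : ∀ k x → + k * pos x ≡ pos (+ k * x)
*-pos k       (+ m)        = trans (sym (ℤP.pos-* k m)) (cong pos (ℤP.pos-* k m))
*-pos zero    ℤ.-[1+ m ] = refl
*-pos (suc k) ℤ.-[1+ m ] = ℤP.*-zeroʳ (+ suc k)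

mutate-at : (k : Fin n) (B : Matrix n) {i j : Fin n} → i ≡ k ⊎ j ≡ k → mutate k B i j ≡ - B i j
mutate-at k B {i} {j} at with i ≟ k | j ≟ k
... | yes _   | _     = refl
... | no _    | yes _ = refl
... | no i≢k  | no j≢k with at
...   | inj₁ i≡k = ⊥-elim (i≢k i≡k)
...   | inj₂ j≡k = ⊥-elim (j≢k j≡k)

mutate-off : (k : Fin n) (B : Matrix n) {i j : Fin n} → i ≢ k → j ≢ k →
  mutate k B i j ≡ B i j + pos (- B i k) * B k j + B i k * pos (B k j)
mutate-off k B {i} {j} i≢k j≢k with i ≟ k | j ≟ k
... | yes i≡k | _       = ⊥-elim (i≢k i≡k)
... | no _    | yes j≡k = ⊥-elim (j≢k j≡k)
... | no _    | no _    = refl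

*-pos-neg : (d : Fin n → ℕ) (B : Matrix n) → SkewSymmetrizer d B →
  ∀ i k → + d i * pos (- B i k) ≡ + d k * pos (B k i)
*-pos-neg d B B-skew i k = begin
  + d i * pos (- B i k)      ≡⟨ *-pos (d i) (- B i k) ⟩
  pos (+ d i * - B i k)      ≡⟨ cong pos (ℤP.neg-distribʳ-* (+ d i) (B i k)) ⟨
  pos (- (+ d i * B i k))    ≡⟨ cong (pos ∘ -_) (B-skew i k) ⟩
  pos (- - (+ d k * B k i))  ≡⟨ cong pos (ℤP.neg-involutive _) ⟩
  pos (+ d k * B k i)        ≡⟨ *-pos (d k) (B k i) ⟨
  + d k * pos (B k i)        ∎
  where open ≡-Reasoning

mutate-off-skew : (d : Fin n → ℕ) (k : Fin n) (B : Matrix n) → SkewSymmetrizer d B →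
  ∀ {i j} → i ≢ k → j ≢ k → + d i * mutate k B i j ≡ - (+ d j * mutate k B j i)
mutate-off-skew d k B B-skew {i} {j} i≢k j≢k = begin
  D i * mutate k B i j
    ≡⟨ cong (D i *_) (mutate-off k B i≢k j≢k) ⟩
  D i * (B i j + P₁ * B k j + B i k * P₂)
    ≡⟨ solve 6 (λ Di bij p₁ bkj bik p₂ → Di :* (bij :+ p₁ :* bkj :+ bik :* p₂)
        := Di :* bij :+ (Di :* p₁) :* bkj :+ (Di :* bik) :* p₂) refl (D i) (B i j) P₁ (B k j) (B i k) P₂ ⟩
  D i * B i j + D i * P₁ * B k j + D i * B i k * P₂
    ≡⟨ cong₂ (λ a b → a + b * B k j + D i * B i k * P₂) (B-skew i j) (*-pos-neg d B B-skew i k) ⟩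
  - (D j * B j i) + D k * P₄ * B k j + D i * B i k * P₂
    ≡⟨ cong (λ c → - (D j * B j i) + D k * P₄ * B k j + c * P₂) (B-skew i k) ⟩
  - (D j * B j i) + D k * P₄ * B k j + - (D k * B k i) * P₂
    ≡⟨ solve 7 (λ Dj bji Dk p₄ bkj bki p₂ → :- (Dj :* bji) :+ Dk :* p₄ :* bkj :+ :- (Dk :* bki) :* p₂
        := :- (Dj :* bji) :+ p₄ :* (Dk :* bkj) :+ :- bki :* (Dk :* p₂))
        refl (D j) (B j i) (D k) P₄ (B k j) (B k i) P₂ ⟩
  - (D j * B j i) + P₄ * (D k * B k j) + - B k i * (D k * P₂)
    ≡⟨ cong₂ (λ a b → - (D j * B j i) + P₄ * a + - B k i * b) (B-skew k j) (sym (*-pos-neg d B B-skew j k)) ⟩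
  - (D j * B j i) + P₄ * - (D j * B j k) + - B k i * (D j * P₃)
    ≡⟨ solve 6 (λ Dj bji p₄ bjk bki p₃ → :- (Dj :* bji) :+ p₄ :* :- (Dj :* bjk) :+ :- bki :* (Dj :* p₃)
        := :- (Dj :* (bji :+ p₃ :* bki :+ bjk :* p₄)))
        refl (D j) (B j i) P₄ (B j k) (B k i) P₃ ⟩
  - (D j * (B j i + P₃ * B k i + B j k * P₄))
    ≡⟨ cong (λ x → - (D j * x)) (mutate-off k B j≢k i≢k) ⟨
  - (D j * mutate k B j i) ∎
  where
  open ≡-Reasoning
  D : Fin _ → ℤ
  D a = + d a
  P₁ P₂ P₃ P₄ : ℤ
  P₁ = pos (- B i k)
  P₂ = pos (B k j)
  P₃ = pos (- B j k)
  P₄ = pos (B k i)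

mutate-skew : (d : Fin n → ℕ) (k : Fin n) (B : Matrix n) → SkewSymmetrizer d B → SkewSymmetrizer d (mutate k B)
mutate-skew d k B B-skew i j = on (i ≟ k) (j ≟ k)
  where
  open ≡-Reasoning
  negated : i ≡ k ⊎ j ≡ k → j ≡ k ⊎ i ≡ k → + d i * mutate k B i j ≡ - (+ d j * mutate k B j i)
  negated at-ij at-ji = begin
    + d i * mutate k B i j     ≡⟨ cong (+ d i *_) (mutate-at k B at-ij) ⟩
    + d i * - B i j            ≡⟨ ℤP.neg-distribʳ-* (+ d i) (B i j) ⟨
    - (+ d i * B i j)          ≡⟨ cong -_ (B-skew i j) ⟩
    - - (+ d j * B j i)        ≡⟨ cong -_ (ℤP.neg-distribʳ-* (+ d j) (B j i)) ⟩
    - (+ d j * - B j i)        ≡⟨ cong (λ x → - (+ d j * x)) (mutate-at k B at-ji) ⟨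
    - (+ d j * mutate k B j i) ∎
  on : Dec (i ≡ k) → Dec (j ≡ k) → + d i * mutate k B i j ≡ - (+ d j * mutate k B j i)
  on (yes i≡k) _         = negated (inj₁ i≡k) (inj₂ i≡k)
  on (no _)    (yes j≡k) = negated (inj₂ j≡k) (inj₁ j≡k)
  on (no i≢k)  (no j≢k)  = mutate-off-skew d k B B-skew i≢k j≢k

-- (I + g e_kᵀ) A (I + e_k cᵀ) with c j = - β j a_kj and g i = - β i a_ik. For D-symmetric A,
-- d_i g_i = d_k c_i, so this is D⁻¹ Eᵀ (D A) E with E = I + e_k cᵀ, again D-symmetric.
shearAt : Fin n → (Fin n → ℤ) → Matrix n → Matrix n
shearAt k β A = addRowMultiples k (λ i → - (β i * A i k)) (addColMultiples k (λ j → - (β j * A k j)) A)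

det-shearAt : (k : Fin n) (β : Fin n → ℤ) → β k ≡ 0ℤ → (A : Matrix n) → det (shearAt k β A) ≡ det A
det-shearAt k β βk≡0 A =
  trans (det-addRowMultiples k (λ i → - (β i * A i k)) (cong (λ b → - (b * A k k)) βk≡0) (addColMultiples k c A))
        (det-addColMultiples k c (cong (λ b → - (b * A k k)) βk≡0) A)
  where
  c : Fin _ → ℤ
  c j = - (β j * A k j)

shearAt-dsym : (d : Fin n → ℕ) (k : Fin n) (β : Fin n → ℤ) (A : Matrix n) → DSymmetric d A →
  DSymmetric d (shearAt k β A)
shearAt-dsym d k β A A-sym i j = trans (expand i j) (trans (Q-sym i j) (sym (expand j i)))
  where
  open ≡-Reasoning
  D : Fin _ → ℤ
  D a = + d a
  S : Fin _ → Fin _ → ℤ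
  S a b = D a * A a b
  c : Fin _ → ℤ
  c j = - (β j * A k j)
  Dg≡cD : ∀ i → D i * - (β i * A i k) ≡ c i * D k
  Dg≡cD i = begin
    D i * - (β i * A i k)      ≡⟨ solve 3 (λ Di b a → Di :* :- (b :* a) := :- (b :* (Di :* a))) refl (D i) (β i) (A i k) ⟩
    - (β i * (D i * A i k))    ≡⟨ cong (λ x → - (β i * x)) (A-sym i k) ⟩
    - (β i * (D k * A k i))    ≡⟨ solve 3 (λ Dk b a → :- (b :* (Dk :* a)) := :- (b :* a) :* Dk) refl (D k) (β i) (A k i) ⟩
    c i * D k                  ∎
  Q : Fin _ → Fin _ → ℤ
  Q i j = S i j + c j * S i k + c i * S k j + c i * c j * S k k
  expand : ∀ i j → D i * shearAt k β A i j ≡ Q i j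
  expand i j = begin
    D i * (A i j + c j * A i k + - (β i * A i k) * (A k j + c j * A k k))
      ≡⟨ solve 6 (λ Di aij cj aik g r → Di :* (aij :+ cj :* aik :+ g :* r) := Di :* aij :+ cj :* (Di :* aik) :+ Di :* g :* r)
               refl (D i) (A i j) (c j) (A i k) (- (β i * A i k)) (A k j + c j * A k k) ⟩
    S i j + c j * S i k + D i * - (β i * A i k) * (A k j + c j * A k k)
      ≡⟨ cong (λ x → S i j + c j * S i k + x * (A k j + c j * A k k)) (Dg≡cD i) ⟩
    S i j + c j * S i k + c i * D k * (A k j + c j * A k k)
      ≡⟨ solve 7 (λ sij cj sik ci Dk akj akk → sij :+ cj :* sik :+ ci :* Dk :* (akj :+ cj :* akk)
                                             := sij :+ cj :* sik :+ ci :* (Dk :* akj) :+ ci :* cj :* (Dk :* akk))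
               refl (S i j) (c j) (S i k) (c i) (D k) (A k j) (A k k) ⟩
    Q i j ∎
  Q-sym : ∀ i j → Q i j ≡ Q j i
  Q-sym i j = begin
    S i j + c j * S i k + c i * S k j + c i * c j * S k k
      ≡⟨ cong₂ (λ x y → x + c j * y + c i * S k j + c i * c j * S k k) (A-sym i j) (A-sym i k) ⟩
    S j i + c j * S k i + c i * S k j + c i * c j * S k k
      ≡⟨ cong (λ x → S j i + c j * S k i + c i * x + c i * c j * S k k) (A-sym k j) ⟩
    S j i + c j * S k i + c i * S j k + c i * c j * S k k
      ≡⟨ solve 6 (λ sji cj ski ci sjk skk → sji :+ cj :* ski :+ ci :* sjk :+ ci :* cj :* skk
                                          := sji :+ ci :* sjk :+ cj :* ski :+ cj :* ci :* skk)
               refl (S j i) (c j) (S k i) (c i) (S j k) (S k k) ⟩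
    Q j i ∎

shearAt-diagonal : (k : Fin n) (β : Fin n → ℤ) (A : Matrix n) → (∀ i → β i * β i ≡ β i) →
  (∀ i → A i i ≡ + 2) → ∀ i → shearAt k β A i i ≡ + 2
shearAt-diagonal k β A β-idem A-diag i = begin
  A i i + - (β i * A k i) * A i k + - (β i * A i k) * (A k i + - (β i * A k i) * A k k)
    ≡⟨ cong₂ (λ x y → x + - (β i * A k i) * A i k + - (β i * A i k) * (A k i + - (β i * A k i) * y)) (A-diag i) (A-diag k) ⟩
  + 2 + - (β i * A k i) * A i k + - (β i * A i k) * (A k i + - (β i * A k i) * + 2)
    ≡⟨ solve 3 (λ b x y → con (+ 2) :+ :- (b :* y) :* x :+ :- (b :* x) :* (y :+ :- (b :* y) :* con (+ 2))
                        := con (+ 2) :+ con (+ 2) :* (b :* b :- b) :* x :* y) refl (β i) (A i k) (A k i) ⟩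
  + 2 + + 2 * (β i * β i - β i) * A i k * A k i
    ≡⟨ cong (λ b → + 2 + + 2 * (b - β i) * A i k * A k i) (β-idem i) ⟩
  + 2 + + 2 * (β i - β i) * A i k * A k i
    ≡⟨ cong (λ x → + 2 + + 2 * x * A i k * A k i) (ℤP.+-inverseʳ (β i)) ⟩
  + 2 + 0ℤ
    ≡⟨ ℤP.+-identityʳ (+ 2) ⟩
  + 2 ∎
  where open ≡-Reasoning

-- Modulo 2 both the mutated matrix and the shear of its quasi-Cartan companion reduce to this.
mutationResidue : Fin n → Matrix n → Matrix n
mutationResidue k B i j = B i j + isPositive (B k j) * B k j * B i k + isPositive (B k i) * B i k * B k j

mutate-≡-mod-2 : (d : Fin n → ℕ) → Positive d → (B : Matrix n) → SkewSymmetrizer d B → (k : Fin n) →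
  ∀ i j → mutate k B i j ≡ mutationResidue k B i j mod 2
mutate-≡-mod-2 d d>0 B B-skew k i j = on (i ≟ k) (j ≟ k)
  where
  open ≡-mod-Reasoning 2
  β : Fin _ → ℤ
  β a = isPositive (B k a)
  Bkk≡0 : B k k ≡ 0ℤ
  Bkk≡0 = skew-diagonal d d>0 B B-skew k
  on : Dec (i ≡ k) → Dec (j ≡ k) → mutate k B i j ≡ mutationResidue k B i j mod 2
  on (yes refl) _ = begin
    mutate k B k j
      ≡⟨ mutate-at k B (inj₁ refl) ⟩
    - B k j
      ≈⟨ neg-≡-mod-2 (B k j) ⟩
    B k j
      ≡⟨ solve 3 (λ x b c → x := x :+ b :* x :* con 0ℤ :+ c :* con 0ℤ :* x) refl (B k j) (β j) (β k) ⟩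
    B k j + β j * B k j * 0ℤ + β k * 0ℤ * B k j
      ≡⟨ cong (λ z → B k j + β j * B k j * z + β k * z * B k j) Bkk≡0 ⟨
    mutationResidue k B k j                         ∎
  on (no _) (yes refl) = begin
    mutate k B i k
      ≡⟨ mutate-at k B (inj₂ refl) ⟩
    - B i k
      ≈⟨ neg-≡-mod-2 (B i k) ⟩
    B i k
      ≡⟨ solve 3 (λ x b c → x := x :+ b :* con 0ℤ :* x :+ c :* x :* con 0ℤ) refl (B i k) (β k) (β i) ⟩
    B i k + β k * 0ℤ * B i k + β i * B i k * 0ℤ
      ≡⟨ cong (λ z → B i k + β k * z * B i k + β i * B i k * z) Bkk≡0 ⟨
    mutationResidue k B i k                         ∎
  on (no i≢k) (no j≢k) = begin
    mutate k B i j
      ≡⟨ mutate-off k B i≢k j≢k ⟩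
    B i j + pos (- B i k) * B k j + B i k * pos (B k j)
      ≡⟨ cong₂ (λ x y → B i j + x * B k j + B i k * y) (pos≡isPositive* (- B i k)) (pos≡isPositive* (B k j)) ⟩
    B i j + isPositive (- B i k) * - B i k * B k j + B i k * (β j * B k j)
      ≡⟨ cong (λ b → B i j + b * - B i k * B k j + B i k * (β j * B k j)) β-neg ⟩
    B i j + β i * - B i k * B k j + B i k * (β j * B k j)
      ≡⟨ solve 5 (λ bij bi bik bkj bj → bij :+ bi :* (:- bik) :* bkj :+ bik :* (bj :* bkj)
                                      := bij :+ bj :* bkj :* bik :+ :- (bi :* bik :* bkj))
               refl (B i j) (β i) (B i k) (B k j) (β j) ⟩
    B i j + β j * B k j * B i k + - (β i * B i k * B k j)
      ≈⟨ +-cong-mod (≡⇒≡-mod {B i j + β j * B k j * B i k} refl) (neg-≡-mod-2 (β i * B i k * B k j)) ⟩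
    mutationResidue k B i j ∎
    where
    β-neg : isPositive (- B i k) ≡ β i
    β-neg = isPositive-sgn (- B i k) (B k i) (trans (sgn-neg (B i k)) (sym (skew-sgn d d>0 B B-skew i k)))

shearAt-≡-mod-2 : (B : Matrix n) → (∀ i → B i i ≡ 0ℤ) → (k : Fin n) →
  ∀ i j → shearAt k (λ a → isPositive (B k a)) (quasiCartan B) i j ≡ mutationResidue k B i j mod 2
shearAt-≡-mod-2 B B-diag k i j = begin
  A i j + - (β j * A k j) * A i k + - (β i * A i k) * (A k j + - (β j * A k j) * A k k)
    ≈⟨ +-cong-mod (+-cong-mod (A≡B i j) (*-cong-mod (neg-cong-mod (β j *≡ A≡B k j)) (A≡B i k)))
        (*-cong-mod (neg-cong-mod (β i *≡ A≡B i k))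
        (+-cong-mod (A≡B k j) (*-cong-mod (neg-cong-mod (β j *≡ A≡B k j)) (A≡B k k)))) ⟩
  B i j + - (β j * B k j) * B i k + - (β i * B i k) * (B k j + - (β j * B k j) * B k k)
    ≡⟨ cong (λ z → B i j + - (β j * B k j) * B i k + - (β i * B i k) * (B k j + - (β j * B k j) * z)) (B-diag k) ⟩
  B i j + - (β j * B k j) * B i k + - (β i * B i k) * (B k j + - (β j * B k j) * 0ℤ)
    ≡⟨ solve 5 (λ bij bj bkj bik bi → bij :+ :- (bj :* bkj) :* bik :+ :- (bi :* bik) :* (bkj :+ :- (bj :* bkj) :* con 0ℤ)
        := bij :+ :- (bj :* bkj :* bik) :+ :- (bi :* bik :* bkj))
        refl (B i j) (β j) (B k j) (B i k) (β i) ⟩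
  B i j + - (β j * B k j * B i k) + - (β i * B i k * B k j)
    ≈⟨ +-cong-mod (+-cong-mod (≡⇒≡-mod {B i j} refl) (neg-≡-mod-2 (β j * B k j * B i k))) (neg-≡-mod-2 (β i * B i k * B k j)) ⟩
  mutationResidue k B i j ∎
  where
  open ≡-mod-Reasoning 2
  A : Matrix _
  A = quasiCartan B
  β : Fin _ → ℤ
  β a = isPositive (B k a)
  A≡B : ∀ a b → A a b ≡ B a b mod 2
  A≡B = quasiCartan-≡-mod-2 B B-diag
  _*≡_ : ∀ x {y y′} → y′ ≡ y mod 2 → x * y′ ≡ x * y mod 2
  x *≡ e = *-cong-mod (≡⇒≡-mod {x} refl) e

det-quasiCartan-mutate : (d : Fin n → ℕ) → Positive d → (B : Matrix n) → SkewSymmetrizer d B → (k : Fin n) →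
  det (quasiCartan (mutate k B)) ≡ det (quasiCartan B) mod 4
det-quasiCartan-mutate d d>0 B B-skew k =
  subst (λ x → det (quasiCartan (mutate k B)) ≡ x mod 4) (det-shearAt k β (cong isPositive (B-diag k)) A)
        (det-≡-mod-4 d d>0 (shearAt k β A) (quasiCartan (mutate k B))
                     (shearAt-dsym d k β A (quasiCartan-dsym d B B-skew))
                     (quasiCartan-dsym d (mutate k B) μB-skew)
                     residues diagonal)
  where
  A : Matrix _
  A = quasiCartan B
  β : Fin _ → ℤ
  β a = isPositive (B k a)
  μB-skew : SkewSymmetrizer d (mutate k B)
  μB-skew = mutate-skew d k B B-skew
  B-diag : ∀ i → B i i ≡ 0ℤ
  B-diag = skew-diagonal d d>0 B B-skew
  residues : ∀ i j → quasiCartan (mutate k B) i j ≡ shearAt k β A i j mod 2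
  residues i j = ≡-mod-trans (quasiCartan-≡-mod-2 (mutate k B) (skew-diagonal d d>0 (mutate k B) μB-skew) i j)
                 (≡-mod-trans (mutate-≡-mod-2 d d>0 B B-skew k i j) (≡-mod-sym (shearAt-≡-mod-2 B B-diag k i j)))
  diagonal : ∀ i → quasiCartan (mutate k B) i i ≡ shearAt k β A i i mod 4
  diagonal i = ≡⇒≡-mod (trans (quasiCartan-diagonal (mutate k B) i)
                              (sym (shearAt-diagonal k β A (λ a → isPositive-idempotent (B k a)) (quasiCartan-diagonal B) i)))

det-quasiCartan-mutations : (d : Fin n → ℕ) → Positive d → {B C : Matrix n} → SkewSymmetrizer d B → Star MutStep B C →
  SkewSymmetrizer d C × det (quasiCartan C) ≡ det (quasiCartan B) mod 4
det-quasiCartan-mutations d d>0 B-skew ε = B-skew , ≡⇒≡-mod refl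
det-quasiCartan-mutations d d>0 B-skew (mut k B ◅ steps) with det-quasiCartan-mutations d d>0 (mutate-skew d k B B-skew) steps
... | C-skew , C≡μB = C-skew , ≡-mod-trans C≡μB (det-quasiCartan-mutate d d>0 B B-skew k)

permute-skew : (d : Fin n → ℕ) (C B′ : Matrix n) (π : Permutation′ n) → SkewSymmetrizer d C →
  (∀ i j → B′ i j ≡ C (π ⟨$⟩ʳ i) (π ⟨$⟩ʳ j)) → SkewSymmetrizer (d ∘ (π ⟨$⟩ʳ_)) B′
permute-skew d C B′ π C-skew B′≡ i j = begin
  + d (π ⟨$⟩ʳ i) * B′ i j                          ≡⟨ cong (+ d (π ⟨$⟩ʳ i) *_) (B′≡ i j) ⟩
  + d (π ⟨$⟩ʳ i) * C (π ⟨$⟩ʳ i) (π ⟨$⟩ʳ j)          ≡⟨ C-skew (π ⟨$⟩ʳ i) (π ⟨$⟩ʳ j) ⟩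
  - (+ d (π ⟨$⟩ʳ j) * C (π ⟨$⟩ʳ j) (π ⟨$⟩ʳ i))      ≡⟨ cong (λ x → - (+ d (π ⟨$⟩ʳ j) * x)) (B′≡ j i) ⟨
  - (+ d (π ⟨$⟩ʳ j) * B′ j i)                      ∎
  where open ≡-Reasoning

det-quasiCartan-permute : (d : Fin n → ℕ) → Positive d → (C B′ : Matrix n) (π : Permutation′ n) →
  SkewSymmetrizer d C → (∀ i j → B′ i j ≡ C (π ⟨$⟩ʳ i) (π ⟨$⟩ʳ j)) →
  det (quasiCartan B′) ≡ det (quasiCartan C) mod 4
det-quasiCartan-permute d d>0 C B′ π C-skew B′≡ =
  subst (λ x → det (quasiCartan B′) ≡ x mod 4) (det-conj π (quasiCartan C))
        (det-≡-mod-4 dπ (d>0 ∘ π⃗) Aπ (quasiCartan B′) (λ i j → quasiCartan-dsym d C C-skew (π⃗ i) (π⃗ j))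
                     (quasiCartan-dsym dπ B′ B′-skew) residues diagonal)
  where
  π⃗ : Fin _ → Fin _
  π⃗ = π ⟨$⟩ʳ_
  dπ : Fin _ → ℕ
  dπ = d ∘ π⃗
  Aπ : Matrix _
  Aπ i j = quasiCartan C (π⃗ i) (π⃗ j)
  B′-skew : SkewSymmetrizer dπ B′
  B′-skew = permute-skew d C B′ π C-skew B′≡
  residues : ∀ i j → quasiCartan B′ i j ≡ Aπ i j mod 2
  residues i j = ≡-mod-trans (quasiCartan-≡-mod-2 B′ (skew-diagonal dπ (d>0 ∘ π⃗) B′ B′-skew) i j)
    (subst (λ x → x ≡ Aπ i j mod 2) (sym (B′≡ i j))
           (≡-mod-sym (quasiCartan-≡-mod-2 C (skew-diagonal d d>0 C C-skew) (π⃗ i) (π⃗ j))))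
  diagonal : ∀ i → quasiCartan B′ i i ≡ Aπ i i mod 4
  diagonal i = ≡⇒≡-mod (trans (quasiCartan-diagonal B′ i) (sym (quasiCartan-diagonal C (π⃗ i))))

theorem1p5 : (n : ℕ) (B B' : Matrix n) → SkewSymmetrizable B →
    MutationEquivalent B B' → δ B' ≡ δ B
theorem1p5 n B B′ (d , d>0 , B-skew) (C , steps , π , B′≡) = ≡-mod⇒%ℕ≡ (begin
  detSym B′
    ≡⟨ detSym≡det-quasiCartan B′ (d ∘ (π ⟨$⟩ʳ_) , d>0 ∘ (π ⟨$⟩ʳ_) , permute-skew d C B′ π C-skew B′≡) ⟩
  det (quasiCartan B′)
    ≈⟨ det-quasiCartan-permute d d>0 C B′ π C-skew B′≡ ⟩
  det (quasiCartan C)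
    ≈⟨ proj₂ mutations ⟩
  det (quasiCartan B)
    ≡⟨ detSym≡det-quasiCartan B (d , d>0 , B-skew) ⟨
  detSym B                 ∎)
  where
  open ≡-mod-Reasoning 4
  mutations : SkewSymmetrizer d C × det (quasiCartan C) ≡ det (quasiCartan B) mod 4
  mutations = det-quasiCartan-mutations d d>0 B-skew steps
  C-skew : SkewSymmetrizer d C
  C-skew = proj₁ mutations
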